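{- Let $n\ge 4$ and let $\mathbf{G}$ be a random labelled planar graph drawn uniformly from $\mathcal{T}_n$. Then: (i) if $P=\{p_1,\dots,p_n\}$ is a labelled $n$-point set in the plane, then $$\mathbb{P}(\mathbf{G}\text{ has a label-preserving straight-line embedding on }P)\le\frac{1}{2^{n-4}(n-3)!};$$ (ii) if $P$ is an $n$-point set in the plane, then $$\mathbb{P}(\mathbf{G}\text{ has a straight-line embedding on }P)\le\frac{16n(n-1)(n-2)}{2^n}.$$
   Context: For $n\ge4$, $\mathcal{T}_n$ is the set of labelled planar triangulations on vertex set $\{v_1,\dots,v_n\}$ defined inductively: $\mathcal{T}_4$ consists only of $K_4$ on $\{v_1,v_2,v_3,v_4\}$; for $n\ge5$, if $T\in\mathcal{T}_{n-1}$ and $v_iv_jv_k$ is a facial triangle of $T$, then the graph obtained from $T$ by adding a new vertex $v_n$ adjacent to $v_i,v_j,v_k$ belongs to $\mathcal{T}_n$. Members are distinguished as labelled graphs (the same underlying graph with different labellings counts as different members). A straight-line embedding of a planar graph on a point set $P\subseteq\mathbb{R}^2$ is an injective map $V(G)\to P$ such that drawing edges as straight segments gives a crossing-free drawing; for a labelled point set $P=\{p_1,\dots,p_n\}$, $G$ has a label-preserving straight-line embedding on $P$ if $v_i\mapsto p_i$ is a straight-line embedding. -}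

module Defs where

open import Level using (Level; _⊔_) renaming (suc to lsuc)
open import Data.Nat using (ℕ; zero; suc)
open import Data.Bool using (Bool; true; false; not; _∨_)
open import Data.Fin using (Fin; inject₁; fromℕ; _≟_)
open import Data.Fin.Patterns using (0F; 1F; 2F; 3F)
open import Data.Vec using (Vec; lookup; tabulate; zipWith; allFin; _∷ʳ_)
open import Data.List using (List; []; _∷_; _++_; map; length)
open import Data.List.Relation.Unary.Any using (_─_)
open import Data.List.Membership.Propositional using (_∈_)
open import Data.List.Relation.Unary.Unique.Propositional using (Unique)
open import Data.Product using (Σ; ∃; _×_; _,_)
open import Data.Sum using (_⊎_)
open import Relation.Nullary using (¬_)
open import Relation.Nullary.Decidable using (⌊_⌋)
open import Relation.Binary.Core using (Rel)
open import Relation.Binary.PropositionalEquality using (_≡_)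
open import Algebra.Bundles using (CommutativeRing)
import Relation.Binary.Structures as RS
open import Function.Definitions using (Injective)
open import Function.Bundles using (_⇔_)

-- Labelled graphs on vertex set {v_1,…,v_n}, vertex v_{k+1} ↦ index k : Fin n.
-- A graph is its adjacency matrix (so ≡ is equality of labelled graphs).

Graph : ℕ → Set
Graph n = Vec (Vec Bool n) n

Adj : ∀ {n} → Graph n → Fin n → Fin n → Set
Adj G a b = lookup (lookup G a) b ≡ true

Triangle : ℕ → Set
Triangle n = Fin n × Fin n × Fin n

K4 : Graph 4
K4 = tabulate λ i → tabulate λ j → not ⌊ i ≟ j ⌋

K4faces : List (Triangle 4)
K4faces = (0F , 1F , 2F) ∷ (0F , 1F , 3F) ∷ (0F , 2F , 3F) ∷ (1F , 2F , 3F) ∷ []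

extend : ∀ {n} → Graph n → Fin n → Fin n → Fin n → Graph (suc n)
extend {n} G i j k =
  zipWith (λ a row → row ∷ʳ isTri a) (allFin n) G ∷ʳ (tabulate isTri ∷ʳ false)
  where
  isTri : Fin n → Bool
  isTri a = ⌊ a ≟ i ⌋ ∨ ⌊ a ≟ j ⌋ ∨ ⌊ a ≟ k ⌋

liftT : ∀ {n} → Triangle n → Triangle (suc n)
liftT (i , j , k) = inject₁ i , inject₁ j , inject₁ k

-- Stacked n G F : G ∈ 𝒯_n and F is its list of facial triangles
-- (faces of the unique planar embedding, tracked through the construction).
data Stacked : (n : ℕ) → Graph n → List (Triangle n) → Set where
  base : Stacked 4 K4 K4faces
  step : ∀ {n G F} → Stacked n G F → ∀ i j k → (m : (i , j , k) ∈ F) →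
         Stacked (suc n) (extend G i j k)
           (map liftT (F ─ m) ++
             ((inject₁ i , inject₁ j , fromℕ n) ∷
              (inject₁ j , inject₁ k , fromℕ n) ∷
              (inject₁ i , inject₁ k , fromℕ n) ∷ []))

InT : (n : ℕ) → Graph n → Set
InT n G = ∃ λ F → Stacked n G F

EnumT : (n : ℕ) → List (Graph n) → Set
EnumT n Ts = Unique Ts × (∀ G → (G ∈ Ts) ⇔ InT n G)

-- The plane: F × F for an ordered field F (e.g. ℝ).

record OrderedField (c ℓ ℓ< : Level) : Set (lsuc (c ⊔ ℓ ⊔ ℓ<)) where
  field
    commutativeRing : CommutativeRing c ℓ
  open CommutativeRing commutativeRing public
  field
    _<_ : Rel Carrier ℓ<
    isStrictTotalOrder : RS.IsStrictTotalOrder _≈_ _<_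
    +-mono-< : ∀ {x y} z → x < y → (x + z) < (y + z)
    *-pos : ∀ {x y} → 0# < x → 0# < y → 0# < (x * y)
    1≉0 : ¬ (1# ≈ 0#)
    inverse : ∀ x → ¬ (x ≈ 0#) → ∃ λ y → (x * y) ≈ 1#

  _≤F_ : Carrier → Carrier → Set (ℓ ⊔ ℓ<)
  x ≤F y = (x < y) ⊎ (x ≈ y)

module Plane {c ℓ ℓ<} (𝔽 : OrderedField c ℓ ℓ<) where
  open OrderedField 𝔽

  Point : Set c
  Point = Carrier × Carrier

  _≈ₚ_ : Point → Point → Set ℓ
  (x , y) ≈ₚ (x' , y') = (x ≈ x') × (y ≈ y')

  OnSeg : Point → Point → Point → Set (c ⊔ ℓ ⊔ ℓ<)
  OnSeg (ax , ay) (bx , by) (qx , qy) =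
    ∃ λ t → (0# ≤F t) × (t ≤F 1#) ×
      (qx ≈ (ax + t * (bx - ax))) × (qy ≈ (ay + t * (by - ay)))

  Distinct : ∀ {n} → (Fin n → Point) → Set ℓ
  Distinct P = ∀ i j → P i ≈ₚ P j → i ≡ j

  LabelledEmbedding : ∀ {n} → Graph n → (Fin n → Point) → Set (c ⊔ ℓ ⊔ ℓ<)
  LabelledEmbedding {n} G P =
    Distinct P ×
    (∀ a b v → Adj G a b → OnSeg (P a) (P b) (P v) → (v ≡ a) ⊎ (v ≡ b)) ×
    (∀ a b a' b' → Adj G a b → Adj G a' b' →
       ¬ ((a ≡ a') × (b ≡ b')) → ¬ ((a ≡ b') × (b ≡ a')) →
       ∀ q → OnSeg (P a) (P b) q → OnSeg (P a') (P b') q →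
       ∃ λ v → ((v ≡ a) ⊎ (v ≡ b)) × ((v ≡ a') ⊎ (v ≡ b')) × (q ≈ₚ P v))

  Embedding : ∀ {n} → Graph n → (Fin n → Point) → Set (c ⊔ ℓ ⊔ ℓ<)
  Embedding {n} G P =
    ∃ λ (σ : Fin n → Fin n) → Injective _≡_ _≡_ σ × LabelledEmbedding G (λ v → P (σ v))

{-# OPTIONS --safe #-}
module Submission where

-- A labelled point set carries at most one member of 𝒯_n. Along the stacking order every point off the
-- drawing of a stacked triangulation is separated by one of its faces (inside that face while the
-- remaining vertices are outside, or conversely for the outer face). The last vertex lies off the drawing
-- of the earlier ones, and an edge from it to a corner of any other face would cross that face's
-- boundary, so the face it was attached to is read off from the points. Hence (i): |𝒯_n| ≥ 2^(n-4)(n-3)!,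
-- as each step offers 2n − 4 faces; and (ii): an unlabelled embedding is a labelled one for one of the n!
-- relabellings of P, and n! 2ⁿ = 16 n (n−1)(n−2) · 2^(n−4) (n−3)!.

open import Algebra.Bundles using (CommutativeRing)
open import Defs

module IntegerCoefficients {c ℓ} (R : CommutativeRing c ℓ) where

  open import Data.Nat as ℕ using (ℕ; zero; suc)
  import Data.Nat.Properties as ℕ
  open import Data.Integer as ℤ using (ℤ; +_; -[1+_]; _⊖_)
  import Data.Integer.Properties as ℤ
  open import Data.Sign as Sign using (Sign)
  open import Data.Maybe using (Maybe; just; nothing)
  open import Relation.Binary.PropositionalEquality as ≡ using (_≡_)
  open import Relation.Nullary using (yes; no)
  import Algebra.Solver.Ring.AlmostCommutativeRing as ACR

  open CommutativeRing R
  open import Algebra.Properties.Ring ring using (-1*x≈-x)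
  open import Algebra.Properties.AbelianGroup +-abelianGroup using (⁻¹-∙-comm)
  open import Algebra.Properties.Group +-group using (⁻¹-involutive; ε⁻¹≈ε)
  open import Algebra.Properties.Semiring.Mult.TCOptimised semiring using (_×_; 1+×; ×-homo-+; ×1-homo-*)
  open import Algebra.Properties.CommutativeSemigroup *-commutativeSemigroup using (interchange)
  open import Relation.Binary.Reasoning.Setoid setoid

  ι : ℤ → Carrier
  ι (+ n)    = n × 1#
  ι -[1+ n ] = - (suc n × 1#)

  ι-homo-⊖ : ∀ m n → ι (m ⊖ n) ≈ m × 1# - n × 1#
  ι-homo-⊖ m       zero    = sym (trans (+-congˡ ε⁻¹≈ε) (+-identityʳ _))
  ι-homo-⊖ zero    (suc n) = sym (+-identityˡ _)
  ι-homo-⊖ (suc m) (suc n) = begin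
    ι (suc m ⊖ suc n)               ≡⟨ ≡.cong ι (ℤ.[1+m]⊖[1+n]≡m⊖n m n) ⟩
    ι (m ⊖ n)                       ≈⟨ ι-homo-⊖ m n ⟩
    m × 1# - n × 1#                 ≈⟨ sym (cancel-1 (m × 1#) (n × 1#)) ⟩
    (1# + m × 1#) - (1# + n × 1#)   ≈⟨ sym (+-cong (1+× m 1#) (-‿cong (1+× n 1#))) ⟩
    suc m × 1# - suc n × 1#         ∎
    where
    cancel-1 : ∀ a b → (1# + a) - (1# + b) ≈ a - b
    cancel-1 a b = begin
      (1# + a) + - (1# + b)     ≈⟨ +-congˡ (sym (⁻¹-∙-comm 1# b)) ⟩
      (1# + a) + (- 1# + - b)   ≈⟨ interchange′ 1# a (- 1#) (- b) ⟩
      (1# + - 1#) + (a + - b)   ≈⟨ +-congʳ (-‿inverseʳ 1#) ⟩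
      0# + (a - b)              ≈⟨ +-identityˡ _ ⟩
      a - b                     ∎
      where
      open import Algebra.Properties.CommutativeSemigroup +-commutativeSemigroup
        renaming (interchange to interchange′)

  ι-homo-+ : ∀ i j → ι (i ℤ.+ j) ≈ ι i + ι j
  ι-homo-+ -[1+ m ] -[1+ n ] = begin
    - (suc (suc (m ℕ.+ n)) × 1#)        ≡⟨ ≡.cong (λ k → - (suc k × 1#)) (≡.sym (ℕ.+-suc m n)) ⟩
    - ((suc m ℕ.+ suc n) × 1#)          ≈⟨ -‿cong (×-homo-+ 1# (suc m) (suc n)) ⟩
    - (suc m × 1# + suc n × 1#)         ≈⟨ sym (⁻¹-∙-comm _ _) ⟩
    - (suc m × 1#) + - (suc n × 1#)     ∎
  ι-homo-+ -[1+ m ] (+ n)    = trans (ι-homo-⊖ n (suc m)) (+-comm _ _)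
  ι-homo-+ (+ m)    -[1+ n ] = ι-homo-⊖ m (suc n)
  ι-homo-+ (+ m)    (+ n)    = ×-homo-+ 1# m n

  ι-homo-‿ : ∀ i → ι (ℤ.- i) ≈ - ι i
  ι-homo-‿ -[1+ n ]  = sym (⁻¹-involutive _)
  ι-homo-‿ (+ zero)  = sym ε⁻¹≈ε
  ι-homo-‿ (+ suc n) = refl

  signValue : Sign → Carrier
  signValue Sign.+ = 1#
  signValue Sign.- = - 1#

  signValue-homo-* : ∀ s t → signValue (s Sign.* t) ≈ signValue s * signValue t
  signValue-homo-* Sign.+ t      = sym (*-identityˡ _)
  signValue-homo-* Sign.- Sign.+ = sym (*-identityʳ _)
  signValue-homo-* Sign.- Sign.- = sym (trans (-1*x≈-x _) (⁻¹-involutive _))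

  ι-◃ : ∀ s n → ι (s ℤ.◃ n) ≈ signValue s * (n × 1#)
  ι-◃ s      zero    = sym (zeroʳ _)
  ι-◃ Sign.+ (suc n) = sym (*-identityˡ _)
  ι-◃ Sign.- (suc n) = sym (-1*x≈-x _)

  ι-sign-abs : ∀ i → ι i ≈ signValue (ℤ.sign i) * (ℤ.∣ i ∣ × 1#)
  ι-sign-abs (+ n)    = sym (*-identityˡ _)
  ι-sign-abs -[1+ n ] = sym (-1*x≈-x _)

  ι-homo-* : ∀ i j → ι (i ℤ.* j) ≈ ι i * ι j
  ι-homo-* i j = begin
    ι (i ℤ.* j)                                                  ≈⟨ ι-◃ (s Sign.* t) (ℤ.∣ i ∣ ℕ.* ℤ.∣ j ∣) ⟩
    signValue (s Sign.* t) * ((ℤ.∣ i ∣ ℕ.* ℤ.∣ j ∣) × 1#)          ≈⟨ *-cong (signValue-homo-* s t) (×1-homo-* ℤ.∣ i ∣ ℤ.∣ j ∣) ⟩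
    (signValue s * signValue t) * (ℤ.∣ i ∣ × 1# * ℤ.∣ j ∣ × 1#)    ≈⟨ interchange _ _ _ _ ⟩
    (signValue s * ℤ.∣ i ∣ × 1#) * (signValue t * ℤ.∣ j ∣ × 1#)    ≈⟨ sym (*-cong (ι-sign-abs i) (ι-sign-abs j)) ⟩
    ι i * ι j                                                    ∎
    where
    s t : Sign
    s = ℤ.sign i
    t = ℤ.sign j

  ι-morphism : ℤ.+-*-rawRing ACR.-Raw-AlmostCommutative⟶ ACR.fromCommutativeRing R
  ι-morphism = record
    { ⟦_⟧    = ι
    ; +-homo = ι-homo-+
    ; *-homo = ι-homo-*
    ; -‿homo = ι-homo-‿
    ; 0-homo = refl
    ; 1-homo = refl
    }

  ι-≟ : ∀ a b → Maybe (ι a ≈ ι b)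
  ι-≟ a b with a ℤ.≟ b
  ... | yes ≡.refl = just refl
  ... | no _       = nothing

  open import Algebra.Solver.Ring ℤ.+-*-rawRing (ACR.fromCommutativeRing R) ι-morphism ι-≟ public
    using (solve; _:=_; _:+_; _:*_; _:-_; :-_; con; Polynomial)

module OrderedFieldProperties {c ℓ ℓ<} (𝔽 : OrderedField c ℓ ℓ<) where

  open import Data.Product using (Σ; _×_; _,_)
  open import Data.Sum using (_⊎_; inj₁; inj₂)
  open import Data.Empty using (⊥; ⊥-elim)
  open import Relation.Nullary using (¬_)
  open import Relation.Binary.Definitions using (tri<; tri≈; tri>)
  import Relation.Binary.Structures as RS

  open OrderedField 𝔽 public
  module O = RS.IsStrictTotalOrder isStrictTotalOrder
  open IntegerCoefficients commutativeRing public
  open import Algebra.Properties.Ring ring public using (-‿distribˡ-*; -‿distribʳ-*)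
  open import Algebra.Properties.AbelianGroup +-abelianGroup public using (⁻¹-∙-comm)
  open import Algebra.Properties.Group +-group public using (⁻¹-involutive; ε⁻¹≈ε)
  open import Relation.Binary.Reasoning.Setoid setoid

  <-resp-≈ : ∀ {x x′ y y′} → x ≈ x′ → y ≈ y′ → x < y → x′ < y′
  <-resp-≈ p q r = O.<-respˡ-≈ p (O.<-respʳ-≈ q r)

  <-asym : ∀ {x y} → x < y → y < x → ⊥
  <-asym = O.asym

  <⇒≉ : ∀ {x y} → x < y → x ≈ y → ⊥
  <⇒≉ p q = O.irrefl q p

  pos-resp : ∀ {x y} → x ≈ y → 0# < x → 0# < y
  pos-resp = O.<-respʳ-≈

  neg-resp : ∀ {x y} → x ≈ y → x < 0# → y < 0#
  neg-resp = O.<-respˡ-≈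

  nonNeg-resp : ∀ {x y} → x ≈ y → 0# ≤F x → 0# ≤F y
  nonNeg-resp e (inj₁ p) = inj₁ (pos-resp e p)
  nonNeg-resp e (inj₂ p) = inj₂ (trans p e)

  nonPos-resp : ∀ {x y} → x ≈ y → x ≤F 0# → y ≤F 0#
  nonPos-resp e (inj₁ p) = inj₁ (neg-resp e p)
  nonPos-resp e (inj₂ p) = inj₂ (trans (sym e) p)

  compare₀ : ∀ x → (0# < x) ⊎ ((x ≈ 0#) ⊎ (x < 0#))
  compare₀ x with O.compare 0# x
  ... | tri< p _ _ = inj₁ p
  ... | tri≈ _ p _ = inj₂ (inj₁ (sym p))
  ... | tri> _ _ p = inj₂ (inj₂ p)

  pos⇒¬nonPos : ∀ {x} → 0# < x → ¬ (x ≤F 0#)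
  pos⇒¬nonPos p (inj₁ q) = <-asym p q
  pos⇒¬nonPos p (inj₂ q) = <⇒≉ p (sym q)

  x-y≈0⇒x≈y : ∀ {x y} → x - y ≈ 0# → x ≈ y
  x-y≈0⇒x≈y {x} {y} p = begin
    x             ≈⟨ sym (+-identityʳ x) ⟩
    x + 0#        ≈⟨ +-congˡ (sym (-‿inverseˡ y)) ⟩
    x + (- y + y) ≈⟨ sym (+-assoc _ _ _) ⟩
    (x - y) + y   ≈⟨ +-congʳ p ⟩
    0# + y        ≈⟨ +-identityˡ y ⟩
    y             ∎

  x≈0⇒y*x≈0 : ∀ {x y} → x ≈ 0# → y * x ≈ 0#
  x≈0⇒y*x≈0 {y = y} p = trans (*-congˡ p) (zeroʳ y)

  x*y≈1⇒1-x*y≈0 : ∀ {x y} → x * y ≈ 1# → 1# - x * y ≈ 0#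
  x*y≈1⇒1-x*y≈0 xy≈1 = trans (+-congˡ (-‿cong xy≈1)) (-‿inverseʳ 1#)

  ≈-by-difference₁ : ∀ {x y a h} → x - y ≈ a * h → h ≈ 0# → x ≈ y
  ≈-by-difference₁ e h≈0 = x-y≈0⇒x≈y (trans e (x≈0⇒y*x≈0 h≈0))

  ≈-by-difference₂ : ∀ {x y a h b k} → x - y ≈ a * h + b * k → h ≈ 0# → k ≈ 0# → x ≈ y
  ≈-by-difference₂ e h≈0 k≈0 =
    x-y≈0⇒x≈y (trans e (trans (+-cong (x≈0⇒y*x≈0 h≈0) (x≈0⇒y*x≈0 k≈0)) (+-identityʳ 0#)))

  x<0⇒0<-x : ∀ {x} → x < 0# → 0# < (- x)
  x<0⇒0<-x {x} p = <-resp-≈ (-‿inverseʳ x) (+-identityˡ (- x)) (+-mono-< (- x) p)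

  0<x⇒-x<0 : ∀ {x} → 0# < x → (- x) < 0#
  0<x⇒-x<0 {x} p = <-resp-≈ (+-identityˡ (- x)) (-‿inverseʳ x) (+-mono-< (- x) p)

  0<-x⇒x<0 : ∀ {x} → 0# < (- x) → x < 0#
  0<-x⇒x<0 {x} p = <-resp-≈ (+-identityˡ x) (-‿inverseˡ x) (+-mono-< x p)

  -x<0⇒0<x : ∀ {x} → (- x) < 0# → 0# < x
  -x<0⇒0<x {x} p = <-resp-≈ (-‿inverseˡ x) (+-identityˡ x) (+-mono-< x p)

  x≤0⇒0≤-x : ∀ {x} → x ≤F 0# → 0# ≤F (- x)
  x≤0⇒0≤-x (inj₁ p) = inj₁ (x<0⇒0<-x p)
  x≤0⇒0≤-x (inj₂ p) = inj₂ (sym (trans (-‿cong p) ε⁻¹≈ε))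

  0≤x⇒-x≤0 : ∀ {x} → 0# ≤F x → (- x) ≤F 0#
  0≤x⇒-x≤0 (inj₁ p) = inj₁ (0<x⇒-x<0 p)
  0≤x⇒-x≤0 (inj₂ p) = inj₂ (trans (-‿cong (sym p)) ε⁻¹≈ε)

  x≤y⇒0≤y-x : ∀ {x y} → x ≤F y → 0# ≤F (y - x)
  x≤y⇒0≤y-x {x} (inj₁ p) = inj₁ (O.<-respˡ-≈ (-‿inverseʳ x) (+-mono-< (- x) p))
  x≤y⇒0≤y-x {x} (inj₂ p) = inj₂ (sym (trans (+-congʳ (sym p)) (-‿inverseʳ x)))

  0≤y-x⇒x≤y : ∀ {x y} → 0# ≤F (y - x) → x ≤F y
  0≤y-x⇒x≤y {x} {y} (inj₁ p) = inj₁ (<-resp-≈ (+-identityˡ x) y-x+x≈y (+-mono-< x p))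
    where
    y-x+x≈y : (y - x) + x ≈ y
    y-x+x≈y = trans (+-assoc _ _ _) (trans (+-congˡ (-‿inverseˡ x)) (+-identityʳ y))
  0≤y-x⇒x≤y (inj₂ p) = inj₂ (sym (x-y≈0⇒x≈y (sym p)))

  -- The shapes X ≈ - Y arise from the antisymmetry of the orientation determinant.
  negated-pos : ∀ {X Y} → X ≈ - Y → Y < 0# → 0# < X
  negated-pos e p = pos-resp (sym e) (x<0⇒0<-x p)

  negated-nonNeg : ∀ {X Y} → X ≈ - Y → 0# ≤F Y → X ≤F 0#
  negated-nonNeg e p = nonPos-resp (sym e) (0≤x⇒-x≤0 p)

  negated-nonPos : ∀ {X Y} → X ≈ - Y → Y ≤F 0# → 0# ≤F X
  negated-nonPos e p = nonNeg-resp (sym e) (x≤0⇒0≤-x p)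

  negated-zero : ∀ {X Y} → X ≈ - Y → X ≈ 0# → Y ≈ 0#
  negated-zero {Y = Y} e z = trans (sym (⁻¹-involutive Y)) (trans (-‿cong (trans (sym e) z)) ε⁻¹≈ε)

  ¬pos≈-pos : ∀ {X Y} → 0# < X → X ≈ - Y → 0# < Y → ⊥
  ¬pos≈-pos p e q = <-asym p (neg-resp (sym e) (0<x⇒-x<0 q))

  +-pos : ∀ {x y} → 0# < x → 0# < y → 0# < (x + y)
  +-pos {x} {y} p q = O.trans q (O.<-respˡ-≈ (+-identityˡ y) (+-mono-< y p))

  +-pos-nonNeg : ∀ {x y} → 0# < x → 0# ≤F y → 0# < (x + y)
  +-pos-nonNeg p (inj₁ q) = +-pos p q
  +-pos-nonNeg {x} p (inj₂ q) = pos-resp (trans (sym (+-identityʳ x)) (+-congˡ q)) p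

  +-nonNeg-pos : ∀ {x y} → 0# ≤F x → 0# < y → 0# < (x + y)
  +-nonNeg-pos {x} {y} p q = pos-resp (+-comm y x) (+-pos-nonNeg q p)

  +-nonNeg : ∀ {x y} → 0# ≤F x → 0# ≤F y → 0# ≤F (x + y)
  +-nonNeg (inj₁ p) q = inj₁ (+-pos-nonNeg p q)
  +-nonNeg p (inj₁ q) = inj₁ (+-nonNeg-pos p q)
  +-nonNeg (inj₂ p) (inj₂ q) = inj₂ (trans (sym (+-identityʳ 0#)) (+-cong p q))

  +-neg-nonPos : ∀ {x y} → x < 0# → y ≤F 0# → (x + y) < 0#
  +-neg-nonPos {x} {y} p q = 0<-x⇒x<0 (pos-resp (⁻¹-∙-comm x y) (+-pos-nonNeg (x<0⇒0<-x p) (x≤0⇒0≤-x q)))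

  +-nonPos : ∀ {x y} → x ≤F 0# → y ≤F 0# → (x + y) ≤F 0#
  +-nonPos {x} {y} p q =
    nonPos-resp (trans (-‿cong (⁻¹-∙-comm x y)) (⁻¹-involutive (x + y))) (0≤x⇒-x≤0 (+-nonNeg (x≤0⇒0≤-x p) (x≤0⇒0≤-x q)))

  +₃-pos : ∀ {x y z} → 0# < x → 0# ≤F y → 0# ≤F z → 0# < ((x + y) + z)
  +₃-pos p q r = +-pos-nonNeg (+-pos-nonNeg p q) r

  +₃-neg : ∀ {x y z} → x < 0# → y ≤F 0# → z ≤F 0# → ((x + y) + z) < 0#
  +₃-neg p q r = +-neg-nonPos (+-neg-nonPos p q) r

  *-pos-neg : ∀ {x y} → 0# < x → y < 0# → (x * y) < 0#
  *-pos-neg {x} {y} p q = 0<-x⇒x<0 (pos-resp (sym (-‿distribʳ-* x y)) (*-pos p (x<0⇒0<-x q)))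

  *-neg-neg : ∀ {x y} → x < 0# → y < 0# → 0# < (x * y)
  *-neg-neg {x} {y} p q = -x<0⇒0<x (neg-resp (sym (-‿distribˡ-* x y)) (*-pos-neg (x<0⇒0<-x p) q))

  *-nonNeg : ∀ {x y} → 0# ≤F x → 0# ≤F y → 0# ≤F (x * y)
  *-nonNeg (inj₁ p) (inj₁ q) = inj₁ (*-pos p q)
  *-nonNeg p (inj₂ q) = inj₂ (sym (x≈0⇒y*x≈0 (sym q)))
  *-nonNeg {y = y} (inj₂ p) q = inj₂ (sym (trans (*-congʳ (sym p)) (zeroˡ y)))

  *-pos-nonPos : ∀ {x y} → 0# < x → y ≤F 0# → (x * y) ≤F 0#
  *-pos-nonPos p (inj₁ q) = inj₁ (*-pos-neg p q)
  *-pos-nonPos p (inj₂ q) = inj₂ (x≈0⇒y*x≈0 q)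

  *-nonPos-pos : ∀ {x y} → x ≤F 0# → 0# < y → (x * y) ≤F 0#
  *-nonPos-pos {x} {y} p q = nonPos-resp (*-comm y x) (*-pos-nonPos q p)

  *-pos-cancelˡ : ∀ {a x} → 0# < a → 0# < (a * x) → 0# < x
  *-pos-cancelˡ {a} {x} p q with compare₀ x
  ... | inj₁ r = r
  ... | inj₂ (inj₁ r) = ⊥-elim (<⇒≉ q (sym (x≈0⇒y*x≈0 r)))
  ... | inj₂ (inj₂ r) = ⊥-elim (<-asym q (*-pos-neg p r))

  square-pos : ∀ {x} → ¬ (x ≈ 0#) → 0# < (x * x)
  square-pos {x} x≉0 with compare₀ x
  ... | inj₁ p = *-pos p p
  ... | inj₂ (inj₁ p) = ⊥-elim (x≉0 p)
  ... | inj₂ (inj₂ p) = *-neg-neg p p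

  square-nonNeg : ∀ x → 0# ≤F (x * x)
  square-nonNeg x with compare₀ x
  ... | inj₁ p = inj₁ (*-pos p p)
  ... | inj₂ (inj₁ p) = inj₂ (sym (x≈0⇒y*x≈0 p))
  ... | inj₂ (inj₂ p) = inj₁ (*-neg-neg p p)

  0<1 : 0# < 1#
  0<1 with O.compare 0# 1#
  ... | tri< p _ _ = p
  ... | tri≈ _ p _ = ⊥-elim (1≉0 (sym p))
  ... | tri> _ _ p = ⊥-elim (<-asym p (pos-resp (*-identityˡ 1#) (*-neg-neg p p)))

  pos-inverse : ∀ {a} → 0# < a → Σ Carrier λ e → (0# < e) × (a * e ≈ 1#)
  pos-inverse {a} p with inverse a (λ e → <⇒≉ p (sym e))
  ... | e , ae≈1 = e , *-pos-cancelˡ p (pos-resp (sym ae≈1) 0<1) , ae≈1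

module PlaneGeometry {c ℓ ℓ<} (𝔽 : OrderedField c ℓ ℓ<) where

  open import Data.Product using (Σ; _×_; _,_; proj₁; proj₂)
  open import Data.Sum using (_⊎_; inj₁; inj₂; swap)
  open import Data.Empty using (⊥; ⊥-elim)
  open import Relation.Nullary using (¬_; Dec; yes; no)
  import Data.Integer as ℤ

  open OrderedFieldProperties 𝔽 public
  open Plane 𝔽 public

  :det : ∀ {n} → (ax ay bx by cx cy : Polynomial n) → Polynomial n
  :det ax ay bx by cx cy = ((bx :- ax) :* (cy :- ay)) :- ((by :- ay) :* (cx :- ax))

  -- Twice the signed area of the triangle abc: positive iff a, b, c are in counter-clockwise order.
  opaque
    det : Point → Point → Point → Carrier
    det (ax , ay) (bx , by) (cx , cy) = ((bx - ax) * (cy - ay)) - ((by - ay) * (cx - ax))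

  -- The polynomial identities of the development, checked by the ring solver over integer coefficients;
  -- det stays opaque everywhere else so that the sign arguments never unfold it.
  opaque
    unfolding det
    det-rotate : ∀ a b c → det a b c ≈ det b c a
    det-rotate a b c = solve 6 (λ ax ay bx by cx cy → :det ax ay bx by cx cy := :det bx by cx cy ax ay) refl
      (proj₁ a) (proj₂ a) (proj₁ b) (proj₂ b) (proj₁ c) (proj₂ c)

    det-swap₂₃ : ∀ a b c → det a c b ≈ - det a b c
    det-swap₂₃ a b c = solve 6 (λ ax ay bx by cx cy → :det ax ay cx cy bx by := :- :det ax ay bx by cx cy) refl
      (proj₁ a) (proj₂ a) (proj₁ b) (proj₂ b) (proj₁ c) (proj₂ c)

    det-swap₁₂ : ∀ a b c → det b a c ≈ - det a b c
    det-swap₁₂ a b c = solve 6 (λ ax ay bx by cx cy → :det bx by ax ay cx cy := :- :det ax ay bx by cx cy) refl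
      (proj₁ a) (proj₂ a) (proj₁ b) (proj₂ b) (proj₁ c) (proj₂ c)

    det-swap₁₃ : ∀ a b c → det c b a ≈ - det a b c
    det-swap₁₃ a b c = solve 6 (λ ax ay bx by cx cy → :det cx cy bx by ax ay := :- :det ax ay bx by cx cy) refl
      (proj₁ a) (proj₂ a) (proj₁ b) (proj₂ b) (proj₁ c) (proj₂ c)

    det-split : ∀ a b c x → det a b c ≈ ((det a b x + det b c x) + det c a x)
    det-split a b c x = solve 8 (λ ax ay bx by cx cy xx xy →
        :det ax ay bx by cx cy := ((:det ax ay bx by xx xy :+ :det bx by cx cy xx xy) :+ :det cx cy ax ay xx xy)) refl
      (proj₁ a) (proj₂ a) (proj₁ b) (proj₂ b) (proj₁ c) (proj₂ c) (proj₁ x) (proj₂ x)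

    det-contain₁ : ∀ x y z u v → (det x y z * det y u v) ≈ ((det y z v * det x y u) + (det x y v * det y u z))
    det-contain₁ x y z u v = solve 10 (λ xx xy yx yy zx zy ux uy vx vy →
        (:det xx xy yx yy zx zy :* :det yx yy ux uy vx vy) :=
        ((:det yx yy zx zy vx vy :* :det xx xy yx yy ux uy) :+ (:det xx xy yx yy vx vy :* :det yx yy ux uy zx zy))) refl
      (proj₁ x) (proj₂ x) (proj₁ y) (proj₂ y) (proj₁ z) (proj₂ z) (proj₁ u) (proj₂ u) (proj₁ v) (proj₂ v)

    det-contain₂ : ∀ x y z u v → (det x y z * det u x v) ≈ ((det z x v * det x y u) + (det x y v * det u x z))
    det-contain₂ x y z u v = solve 10 (λ xx xy yx yy zx zy ux uy vx vy →
        (:det xx xy yx yy zx zy :* :det ux uy xx xy vx vy) :=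
        ((:det zx zy xx xy vx vy :* :det xx xy yx yy ux uy) :+ (:det xx xy yx yy vx vy :* :det ux uy xx xy zx zy))) refl
      (proj₁ x) (proj₂ x) (proj₁ y) (proj₂ y) (proj₁ z) (proj₂ z) (proj₁ u) (proj₂ u) (proj₁ v) (proj₂ v)

    det-syzygy : ∀ a b c w q → (((det b c w * det w a q) + (det c a w * det w b q)) + (det a b w * det w c q)) ≈ 0#
    det-syzygy a b c w q = solve 10 (λ ax ay bx by cx cy wx wy qx qy →
        (((:det bx by cx cy wx wy :* :det wx wy ax ay qx qy) :+ (:det cx cy ax ay wx wy :* :det wx wy bx by qx qy)) :+ (:det ax ay bx by wx wy :* :det wx wy cx cy qx qy)) := con (ℤ.+ 0)) refl
      (proj₁ a) (proj₂ a) (proj₁ b) (proj₂ b) (proj₁ c) (proj₂ c) (proj₁ w) (proj₂ w) (proj₁ q) (proj₂ q)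

    det-exit₁ : ∀ x y z A B → (det x y A * det y z B) ≈ ((det x y B * det y z A) - (det A y B * det x y z))
    det-exit₁ x y z A B = solve 10 (λ xx xy yx yy zx zy ax ay bx by →
        (:det xx xy yx yy ax ay :* :det yx yy zx zy bx by) :=
        ((:det xx xy yx yy bx by :* :det yx yy zx zy ax ay) :- (:det ax ay yx yy bx by :* :det xx xy yx yy zx zy))) refl
      (proj₁ x) (proj₂ x) (proj₁ y) (proj₂ y) (proj₁ z) (proj₂ z) (proj₁ A) (proj₂ A) (proj₁ B) (proj₂ B)

    det-exit₂ : ∀ x y z A B → (det x y A * det z x B) ≈ ((det x y B * det z x A) + (det A x B * det x y z))
    det-exit₂ x y z A B = solve 10 (λ xx xy yx yy zx zy ax ay bx by →
        (:det xx xy yx yy ax ay :* :det zx zy xx xy bx by) :=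
        ((:det xx xy yx yy bx by :* :det zx zy xx xy ax ay) :+ (:det ax ay xx xy bx by :* :det xx xy yx yy zx zy))) refl
      (proj₁ x) (proj₂ x) (proj₁ y) (proj₂ y) (proj₁ z) (proj₂ z) (proj₁ A) (proj₂ A) (proj₁ B) (proj₂ B)

    onSeg-identityˣ : ∀ x y z r e → (proj₁ r - (proj₁ x + ((det z x r * e) * (proj₁ y - proj₁ x)))) ≈
           (((proj₁ r - proj₁ x) * (1# - (det x y z * e))) + ((e * (proj₁ z - proj₁ x)) * det x y r))
    onSeg-identityˣ x y z r e = solve 9 (λ xx xy yx yy zx zy rx ry e →
        (rx :- (xx :+ ((:det zx zy xx xy rx ry :* e) :* (yx :- xx)))) :=
        (((rx :- xx) :* (con (ℤ.+ 1) :- (:det xx xy yx yy zx zy :* e))) :+ ((e :* (zx :- xx)) :* :det xx xy yx yy rx ry))) refl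
      (proj₁ x) (proj₂ x) (proj₁ y) (proj₂ y) (proj₁ z) (proj₂ z) (proj₁ r) (proj₂ r) e

    onSeg-identityʸ : ∀ x y z r e → (proj₂ r - (proj₂ x + ((det z x r * e) * (proj₂ y - proj₂ x)))) ≈
           (((proj₂ r - proj₂ x) * (1# - (det x y z * e))) + ((e * (proj₂ z - proj₂ x)) * det x y r))
    onSeg-identityʸ x y z r e = solve 9 (λ xx xy yx yy zx zy rx ry e →
        (ry :- (xy :+ ((:det zx zy xx xy rx ry :* e) :* (yy :- xy)))) :=
        (((ry :- xy) :* (con (ℤ.+ 1) :- (:det xx xy yx yy zx zy :* e))) :+ ((e :* (zy :- xy)) :* :det xx xy yx yy rx ry))) refl
      (proj₁ x) (proj₂ x) (proj₁ y) (proj₂ y) (proj₁ z) (proj₂ z) (proj₁ r) (proj₂ r) e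

    onSeg-identityᵗ : ∀ x y z r e → ((1# - (det z x r * e)) - ((det y z r + det x y r) * e)) ≈ (1# * (1# - (det x y z * e)))
    onSeg-identityᵗ x y z r e = solve 9 (λ xx xy yx yy zx zy rx ry e →
        ((con (ℤ.+ 1) :- (:det zx zy xx xy rx ry :* e)) :- ((:det yx yy zx zy rx ry :+ :det xx xy yx yy rx ry) :* e)) :=
        (con (ℤ.+ 1) :* (con (ℤ.+ 1) :- (:det xx xy yx yy zx zy :* e)))) refl
      (proj₁ x) (proj₂ x) (proj₁ y) (proj₂ y) (proj₁ z) (proj₂ z) (proj₁ r) (proj₂ r) e

    crossing-identityˣ : ∀ p q r s e →
        ((proj₁ p + ((- det r s p * e) * (proj₁ q - proj₁ p))) - (proj₁ r + ((det p q r * e) * (proj₁ s - proj₁ r)))) ≈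
            ((proj₁ p - proj₁ r) * (1# - ((det p q r - det p q s) * e)))
    crossing-identityˣ p q r s e = solve 9 (λ px py qx qy rx ry sx sy e →
        ((px :+ ((:- :det rx ry sx sy px py :* e) :* (qx :- px))) :- (rx :+ ((:det px py qx qy rx ry :* e) :* (sx :- rx)))) :=
        ((px :- rx) :* (con (ℤ.+ 1) :- ((:det px py qx qy rx ry :- :det px py qx qy sx sy) :* e)))) refl
      (proj₁ p) (proj₂ p) (proj₁ q) (proj₂ q) (proj₁ r) (proj₂ r) (proj₁ s) (proj₂ s) e

    crossing-identityʸ : ∀ p q r s e →
        ((proj₂ p + ((- det r s p * e) * (proj₂ q - proj₂ p))) - (proj₂ r + ((det p q r * e) * (proj₂ s - proj₂ r)))) ≈
            ((proj₂ p - proj₂ r) * (1# - ((det p q r - det p q s) * e)))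
    crossing-identityʸ p q r s e = solve 9 (λ px py qx qy rx ry sx sy e →
        ((py :+ ((:- :det rx ry sx sy px py :* e) :* (qy :- py))) :- (ry :+ ((:det px py qx qy rx ry :* e) :* (sy :- ry)))) :=
        ((py :- ry) :* (con (ℤ.+ 1) :- ((:det px py qx qy rx ry :- :det px py qx qy sx sy) :* e)))) refl
      (proj₁ p) (proj₂ p) (proj₁ q) (proj₂ q) (proj₁ r) (proj₂ r) (proj₁ s) (proj₂ s) e

    crossing-identityᵗ : ∀ p q r s e → ((1# - (- det r s p * e)) - (det r s q * e)) ≈
        (1# * (1# - ((det p q r - det p q s) * e)))
    crossing-identityᵗ p q r s e = solve 9 (λ px py qx qy rx ry sx sy e →
        ((con (ℤ.+ 1) :- (:- :det rx ry sx sy px py :* e)) :- (:det rx ry sx sy qx qy :* e)) :=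
        (con (ℤ.+ 1) :* (con (ℤ.+ 1) :- ((:det px py qx qy rx ry :- :det px py qx qy sx sy) :* e)))) refl
      (proj₁ p) (proj₂ p) (proj₁ q) (proj₂ q) (proj₁ r) (proj₂ r) (proj₁ s) (proj₂ s) e

    crossing-identityᵘ : ∀ p q r s e → ((1# - (det p q r * e)) - (- det p q s * e)) ≈
        (1# * (1# - ((det p q r - det p q s) * e)))
    crossing-identityᵘ p q r s e = solve 9 (λ px py qx qy rx ry sx sy e →
        ((con (ℤ.+ 1) :- (:det px py qx qy rx ry :* e)) :- (:- :det px py qx qy sx sy :* e)) :=
        (con (ℤ.+ 1) :* (con (ℤ.+ 1) :- ((:det px py qx qy rx ry :- :det px py qx qy sx sy) :* e)))) refl
      (proj₁ p) (proj₂ p) (proj₁ q) (proj₂ q) (proj₁ r) (proj₂ r) (proj₁ s) (proj₂ s) e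

    reverse-param : ∀ a b t → (b + ((1# - t) * (a - b))) ≈ (a + (t * (b - a)))
    reverse-param = solve 3 (λ a b t → (b :+ ((con (ℤ.+ 1) :- t) :* (a :- b))) := (a :+ (t :* (b :- a)))) refl

    1-[1-t]≈t : ∀ t → (1# - (1# - t)) ≈ t
    1-[1-t]≈t = solve 1 (λ t → (con (ℤ.+ 1) :- (con (ℤ.+ 1) :- t)) := t) refl

    -- b rotated by a quarter turn about a, so that det a b (perp a b) = |b − a|².
    perp : Point → Point → Point
    perp a b = (proj₁ a - (proj₂ b - proj₂ a)) , (proj₂ a + (proj₁ b - proj₁ a))

    det-perp : ∀ a b → det a b (perp a b) ≈
        (((proj₁ b - proj₁ a) * (proj₁ b - proj₁ a)) + ((proj₂ b - proj₂ a) * (proj₂ b - proj₂ a)))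
    det-perp a b = solve 4 (λ ax ay bx by →
        :det ax ay bx by (ax :- (by :- ay)) (ay :+ (bx :- ax)) :=
            (((bx :- ax) :* (bx :- ax)) :+ ((by :- ay) :* (by :- ay)))) refl
      (proj₁ a) (proj₂ a) (proj₁ b) (proj₂ b)

  -- r = x + t (y − x) with the barycentric coordinate t = det z x r / det x y z.
  collinear⇒onSeg : ∀ x y z r → 0# < det x y z → det x y r ≈ 0# → 0# ≤F det y z r → 0# ≤F det z x r → OnSeg x y r
  collinear⇒onSeg x y z r K0 γ0 α0 β0 with pos-inverse K0
  ... | e , e0 , Ke = (det z x r * e) , *-nonNeg β0 (inj₁ e0) , 0≤y-x⇒x≤y tle ,
                       ≈-by-difference₂ (onSeg-identityˣ x y z r e) h0 γ0 , ≈-by-difference₂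
                           (onSeg-identityʸ x y z r e) h0 γ0
    where
    h0 : 1# - det x y z * e ≈ 0#
    h0 = x*y≈1⇒1-x*y≈0 Ke
    tle : 0# ≤F (1# - (det z x r * e))
    tle = nonNeg-resp (sym (≈-by-difference₁ (onSeg-identityᵗ x y z r e) h0))
        (*-nonNeg (+-nonNeg α0 (inj₂ (sym γ0))) (inj₁ e0))

  onSeg-sym : ∀ a b q → OnSeg a b q → OnSeg b a q
  onSeg-sym a b q (t , t0 , t1 , ex , ey) =
    (1# - t) , x≤y⇒0≤y-x t1 , 0≤y-x⇒x≤y (nonNeg-resp (sym (1-[1-t]≈t t)) t0) ,
    trans ex (sym (reverse-param (proj₁ a) (proj₁ b) t)) , trans ey (sym (reverse-param (proj₂ a) (proj₂ b) t))

  -- Cramer's rule: pq and rs meet at parameter t = − det r s p / (det p q r − det p q s) along pq.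
  segments-cross : ∀ p q r s → 0# < det p q r → (det p q s ≤F 0#) → (det r s p ≤F 0#) → 0# ≤F det r s q →
       Σ Point (λ X → OnSeg p q X × OnSeg r s X)
  segments-cross p q r s γ0 δ0 α0 β0 with pos-inverse (+-pos-nonNeg γ0 (x≤0⇒0≤-x δ0))
  ... | e , e0 , Ee = X , (t , *-nonNeg (x≤0⇒0≤-x α0) (inj₁ e0) , 0≤y-x⇒x≤y t1 , refl , refl) ,
                          (u , *-nonNeg (inj₁ γ0) (inj₁ e0) , 0≤y-x⇒x≤y u1 , ≈-by-difference₁ (crossing-identityˣ p q r s e) h0 , ≈-by-difference₁ (crossing-identityʸ p q r s e) h0)
    where
    h0 : 1# - (det p q r - det p q s) * e ≈ 0#
    h0 = x*y≈1⇒1-x*y≈0 Ee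
    t u : Carrier
    t = (- det r s p) * e
    u = det p q r * e
    X : Point
    X = (proj₁ p + (t * (proj₁ q - proj₁ p))) , (proj₂ p + (t * (proj₂ q - proj₂ p)))
    t1 : 0# ≤F (1# - t)
    t1 = nonNeg-resp (sym (≈-by-difference₁ (crossing-identityᵗ p q r s e) h0)) (*-nonNeg β0 (inj₁ e0))
    u1 : 0# ≤F (1# - u)
    u1 = nonNeg-resp (sym (≈-by-difference₁ (crossing-identityᵘ p q r s e) h0)) (*-nonNeg (x≤0⇒0≤-x δ0) (inj₁ e0))

  record InCCW (a b c q : Point) : Set ℓ< where
    constructor inCCW
    field
      side₁ : 0# < det a b q
      side₂ : 0# < det b c q
      side₃ : 0# < det c a q

  data InTriangle (a b c q : Point) : Set ℓ< where
    ccw : InCCW a b c q → InTriangle a b c q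
    cw : InCCW a c b q → InTriangle a b c q

  inCCW-rotate : ∀ {a b c q} → InCCW a b c q → InCCW b c a q
  inCCW-rotate (inCCW p q r) = inCCW q r p

  inCCW⇒det-pos : ∀ {a b c q} → InCCW a b c q → 0# < det a b c
  inCCW⇒det-pos {a} {b} {c} {q} (inCCW p₁ p₂ p₃) = pos-resp (sym (det-split a b c q)) (+-pos (+-pos p₁ p₂) p₃)

  inTriangle-rotate : ∀ {a b c q} → InTriangle a b c q → InTriangle b c a q
  inTriangle-rotate (ccw p) = ccw (inCCW-rotate p)
  inTriangle-rotate (cw p) = cw (inCCW-rotate (inCCW-rotate p))

  inTriangle-swap₁₂ : ∀ {a b c q} → InTriangle a b c q → InTriangle b a c q
  inTriangle-swap₁₂ (ccw p) = cw (inCCW-rotate p)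
  inTriangle-swap₁₂ (cw p) = ccw (inCCW-rotate (inCCW-rotate p))

  inCCW? : ∀ a b c q → Dec (InCCW a b c q)
  inCCW? a b c q with O._<?_ 0# (det a b q) | O._<?_ 0# (det b c q) | O._<?_ 0# (det c a q)
  ... | yes p | yes r | yes s = yes (inCCW p r s)
  ... | no np | _ | _ = no (λ z → np (InCCW.side₁ z))
  ... | yes _ | no np | _ = no (λ z → np (InCCW.side₂ z))
  ... | yes _ | yes _ | no np = no (λ z → np (InCCW.side₃ z))

  inTriangle? : ∀ a b c q → Dec (InTriangle a b c q)
  inTriangle? a b c q with inCCW? a b c q | inCCW? a c b q
  ... | yes p | _ = yes (ccw p)
  ... | no _ | yes p = yes (cw p)
  ... | no p | no r = no λ { (ccw z) → p z ; (cw z) → r z }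

  ¬inCCW-both-orientations : ∀ {a b c q v} → InCCW a b c q → InCCW a c b v → ⊥
  ¬inCCW-both-orientations {a} {b} {c} p r = ¬pos≈-pos (inCCW⇒det-pos r) (det-swap₂₃ a b c) (inCCW⇒det-pos p)

  det-rotate² : ∀ a b c → det a b c ≈ det c a b
  det-rotate² a b c = trans (det-rotate a b c) (det-rotate b c a)

  det-perp-pos : ∀ a b → ¬ (a ≈ₚ b) → 0# < det a b (perp a b)
  det-perp-pos a b nab with O._≟_ (proj₁ a) (proj₁ b)
  ... | no ne = pos-resp (sym (det-perp a b)) (+-pos-nonNeg (square-pos (λ z → ne (sym (x-y≈0⇒x≈y z)))) (square-nonNeg _))
  ... | yes eq = pos-resp (sym (det-perp a b))
      (+-nonNeg-pos (square-nonNeg _) (square-pos (λ z → nab (eq , sym (x-y≈0⇒x≈y z)))))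

  collinear-onSeg : ∀ a b c → ¬ (a ≈ₚ b) → det a b c ≈ 0# → OnSeg a b c ⊎ (OnSeg a c b ⊎ OnSeg c b a)
  collinear-onSeg a b c nab γ0 = go (compare₀ u) (compare₀ v)
    where
    z : Point
    z = perp a b
    N0 : 0# < det a b z
    N0 = det-perp-pos a b nab
    u v : Carrier
    u = det b z c
    v = det z a c
    Ns : det a b z ≈ ((det a b c + u) + v)
    Ns = det-split a b z c
    contra : (u ≤F 0#) → (v ≤F 0#) → ⊥
    contra pu pv = pos⇒¬nonPos N0 (nonPos-resp (sym Ns) (+-nonPos (+-nonPos (inj₂ γ0) pu) pv))
    case1 : 0# ≤F u → 0# ≤F v → OnSeg a b c ⊎ (OnSeg a c b ⊎ OnSeg c b a)
    case1 pu pv = inj₁ (collinear⇒onSeg a b z c N0 γ0 pu pv)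
    case2 : u < 0# → 0# < v → OnSeg a b c ⊎ (OnSeg a c b ⊎ OnSeg c b a)
    case2 pu pv = inj₂ (inj₁ (collinear⇒onSeg a c z b (pos-resp (sym (trans (det-rotate a c z) (det-rotate c z a))) pv)
      (trans (det-swap₂₃ a b c) (trans (-‿cong γ0) ε⁻¹≈ε))
      (negated-nonPos (trans (det-swap₂₃ c b z) (-‿cong (det-rotate c b z))) (inj₁ pu))
      (inj₁ (pos-resp (det-rotate² a b z) N0))))
    case3 : 0# < u → v < 0# → OnSeg a b c ⊎ (OnSeg a c b ⊎ OnSeg c b a)
    case3 pu pv = inj₂ (inj₂ (collinear⇒onSeg c b z a (pos-resp (sym (det-rotate c b z)) pu)
      (trans (trans (det-rotate c b a) (det-rotate b a c)) (trans (det-swap₂₃ a b c) (trans (-‿cong γ0) ε⁻¹≈ε)))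
      (inj₁ (pos-resp (det-rotate a b z) N0))
      (negated-nonPos (det-swap₂₃ z a c) (inj₁ pv))))
    go : _ → _ → OnSeg a b c ⊎ (OnSeg a c b ⊎ OnSeg c b a)
    go (inj₁ pu) (inj₁ pv) = case1 (inj₁ pu) (inj₁ pv)
    go (inj₁ pu) (inj₂ (inj₁ pv)) = case1 (inj₁ pu) (inj₂ (sym pv))
    go (inj₁ pu) (inj₂ (inj₂ pv)) = case3 pu pv
    go (inj₂ (inj₁ pu)) (inj₁ pv) = case1 (inj₂ (sym pu)) (inj₁ pv)
    go (inj₂ (inj₁ pu)) (inj₂ (inj₁ pv)) = case1 (inj₂ (sym pu)) (inj₂ (sym pv))
    go (inj₂ (inj₁ pu)) (inj₂ (inj₂ pv)) = ⊥-elim (contra (inj₂ pu) (inj₁ pv))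
    go (inj₂ (inj₂ pu)) (inj₁ pv) = case2 pu pv
    go (inj₂ (inj₂ pu)) (inj₂ pv) = ⊥-elim (contra (inj₁ pu) (swap pv))

  ¬inTriangle-exchange : ∀ {x y z u} → InTriangle x y z u → InTriangle x y u z → ⊥
  ¬inTriangle-exchange {x} {y} {z} {u} (ccw (inCCW p₁ p₂ p₃)) (ccw (inCCW q1 q2 q3)) = ¬pos≈-pos q2 (det-swap₂₃ y z u) p₂
  ¬inTriangle-exchange {x} {y} {z} {u} (ccw p) (cw (inCCW q1 q2 q3)) = ¬pos≈-pos q3 (det-swap₁₂ x y z) (inCCW⇒det-pos p)
  ¬inTriangle-exchange {x} {y} {z} {u} (cw p) (ccw (inCCW q1 q2 q3)) = ¬pos≈-pos q1 (det-swap₂₃ x z y) (inCCW⇒det-pos p)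
  ¬inTriangle-exchange {x} {y} {z} {u} (cw (inCCW p₁ p₂ p₃)) (cw (inCCW q1 q2 q3)) =
    ¬pos≈-pos q2 (trans (det-rotate u y z) (trans (det-swap₂₃ y u z) (-‿cong (sym (det-rotate z y u))))) p₂

  inCCW-trans : ∀ {x y u z v} → InCCW x y u z → InTriangle x y z v → InCCW x y u v
  inCCW-trans {x} {y} {u} {z} {v} (inCCW a1 a2 a3) (cw q) = ⊥-elim (¬pos≈-pos a1 (det-swap₂₃ x z y) (inCCW⇒det-pos q))
  inCCW-trans {x} {y} {u} {z} {v} P@(inCCW a1 a2 a3) (ccw (inCCW b1 b2 b3)) =
    inCCW b1 (*-pos-cancelˡ a1 (pos-resp (sym (det-contain₁ x y z u v)) (+-pos (*-pos b2 K) (*-pos b1 a2))))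
          (*-pos-cancelˡ a1 (pos-resp (sym (det-contain₂ x y z u v)) (+-pos (*-pos b3 K) (*-pos b1 a3))))
    where
    K : 0# < det x y u
    K = inCCW⇒det-pos P

  inTriangle-trans : ∀ {x y u z v} → InTriangle x y u z → InTriangle x y z v → InTriangle x y u v
  inTriangle-trans (ccw P) iv = ccw (inCCW-trans P iv)
  inTriangle-trans (cw P) iv = cw (inCCW-rotate (inCCW-trans (inCCW-rotate (inCCW-rotate P)) (inTriangle-swap₁₂ iv)))

  ¬inTriangle-opposite : ∀ {a b w c v} → InTriangle a b w c → InTriangle a b c v → InTriangle b c w v → ⊥
  ¬inTriangle-opposite {a} {b} {w} {c} {v} (ccw (inCCW k1 k2 k3)) (cw q) _ = ¬pos≈-pos k1 (det-swap₂₃ a c b)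
      (inCCW⇒det-pos q)
  ¬inTriangle-opposite {a} {b} {w} {c} {v} (ccw (inCCW k1 k2 k3)) (ccw (inCCW r1 r2 r3)) (ccw s) = ¬pos≈-pos k2
      (det-swap₂₃ b c w) (inCCW⇒det-pos s)
  ¬inTriangle-opposite {a} {b} {w} {c} {v} (ccw (inCCW k1 k2 k3)) (ccw (inCCW r1 r2 r3)) (cw (inCCW s1 s2 s3)) = ¬pos≈-pos s3
      (det-swap₁₂ b c v) r2
  ¬inTriangle-opposite {a} {b} {w} {c} {v} (cw (inCCW k1 k2 k3)) (ccw q) _ = ¬pos≈-pos k3 (det-swap₁₂ a b c)
      (inCCW⇒det-pos q)
  ¬inTriangle-opposite {a} {b} {w} {c} {v} (cw (inCCW k1 k2 k3)) (cw (inCCW r1 r2 r3)) (ccw (inCCW s1 s2 s3)) = ¬pos≈-pos r2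
      (det-swap₁₂ b c v) s1
  ¬inTriangle-opposite {a} {b} {w} {c} {v} (cw (inCCW k1 k2 k3)) (cw (inCCW r1 r2 r3)) (cw s) = ¬pos≈-pos k2
      (det-swap₁₂ b w c) (inCCW⇒det-pos s)

  -- w splits abc into abw, bcw, caw; the signs of α, β, γ say on which side of wa, wb, wc the point q lies,
  -- and the syzygy rules out three equal signs.
  module Subdivision {a b c q w : Point} (Q : InCCW a b c q) (W : InCCW a b c w) where
    α β γ : Carrier
    α = det w a q
    β = det w b q
    γ = det w c q
    rel : (((det b c w * α) + (det c a w * β)) + (det a b w * γ)) ≈ 0#
    rel = det-syzygy a b c w q
    la : 0# < det b c w
    la = InCCW.side₂ W
    lb : 0# < det c a w
    lb = InCCW.side₃ W
    lc : 0# < det a b w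
    lc = InCCW.side₁ W
    onSeg-wa : α ≈ 0# → (β ≤F 0#) → OnSeg w a q
    onSeg-wa a0 bn = collinear⇒onSeg w a b q (pos-resp (det-rotate² a b w) (InCCW.side₁ W)) a0 (inj₁ (InCCW.side₁ Q))
        (negated-nonPos (det-swap₁₂ w b q) bn)
    onSeg-wa′ : α ≈ 0# → 0# ≤F γ → OnSeg w a q
    onSeg-wa′ a0 gn = onSeg-sym a w q (collinear⇒onSeg a w c q (pos-resp (det-rotate c a w) (InCCW.side₃ W))
      (trans (det-swap₁₂ w a q) (trans (-‿cong a0) ε⁻¹≈ε)) gn (inj₁ (InCCW.side₃ Q)))
    ¬all-nonNeg : 0# < α → 0# ≤F β → 0# ≤F γ → ⊥
    ¬all-nonNeg p r s = <⇒≉ (+₃-pos (*-pos la p) (*-nonNeg (inj₁ lb) r) (*-nonNeg (inj₁ lc) s)) (sym rel)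
    ¬all-nonPos : α < 0# → (β ≤F 0#) → (γ ≤F 0#) → ⊥
    ¬all-nonPos p r s = <⇒≉ (+₃-neg (*-pos-neg la p) (*-pos-nonPos lb r) (*-pos-nonPos lc s)) rel
    in-abw : 0# < α → β < 0# → InCCW a b w q
    in-abw p r = inCCW (InCCW.side₁ Q) (negated-pos (det-swap₁₂ w b q) r) p
    in-bcw : 0# < β → γ < 0# → InCCW b c w q
    in-bcw p r = inCCW (InCCW.side₂ Q) (negated-pos (det-swap₁₂ w c q) r) p
    in-caw : 0# < γ → α < 0# → InCCW c a w q
    in-caw p r = inCCW (InCCW.side₃ Q) (negated-pos (det-swap₁₂ w a q) r) p

  inCCW-subdivide : ∀ a b c q w → InCCW a b c q → InCCW a b c w →
    ¬ OnSeg w a q → ¬ OnSeg w b q → ¬ OnSeg w c q →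
    InCCW a b w q ⊎ (InCCW b c w q ⊎ InCCW c a w q)
  inCCW-subdivide a b c q w Q W na nb nc = go (compare₀ α) (compare₀ β) (compare₀ γ)
    where
    open Subdivision Q W
    module B = Subdivision (inCCW-rotate Q) (inCCW-rotate W)
    module C = Subdivision (inCCW-rotate (inCCW-rotate Q)) (inCCW-rotate (inCCW-rotate W))
    R : Set ℓ<
    R = InCCW a b w q ⊎ (InCCW b c w q ⊎ InCCW c a w q)
    go : _ → _ → _ → R
    go (inj₁ pa) (inj₂ (inj₂ nb')) _ = inj₁ (in-abw pa nb')
    go (inj₁ pa) (inj₁ pb) (inj₂ (inj₂ ng)) = inj₂ (inj₁ (in-bcw pb ng))
    go (inj₁ pa) (inj₂ (inj₁ zb)) (inj₂ (inj₂ ng)) = ⊥-elim (nb (B.onSeg-wa zb (inj₁ ng)))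
    go (inj₁ pa) (inj₁ pb) (inj₁ pg) = ⊥-elim (¬all-nonNeg pa (inj₁ pb) (inj₁ pg))
    go (inj₁ pa) (inj₁ pb) (inj₂ (inj₁ zg)) = ⊥-elim (¬all-nonNeg pa (inj₁ pb) (inj₂ (sym zg)))
    go (inj₁ pa) (inj₂ (inj₁ zb)) (inj₁ pg) = ⊥-elim (¬all-nonNeg pa (inj₂ (sym zb)) (inj₁ pg))
    go (inj₁ pa) (inj₂ (inj₁ zb)) (inj₂ (inj₁ zg)) = ⊥-elim (¬all-nonNeg pa (inj₂ (sym zb)) (inj₂ (sym zg)))
    go (inj₂ (inj₂ na')) _ (inj₁ pg) = inj₂ (inj₂ (in-caw pg na'))
    go (inj₂ (inj₂ na')) (inj₁ pb) (inj₂ (inj₂ ng)) = inj₂ (inj₁ (in-bcw pb ng))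
    go (inj₂ (inj₂ na')) (inj₁ pb) (inj₂ (inj₁ zg)) = ⊥-elim (nc (C.onSeg-wa zg (inj₁ na')))
    go (inj₂ (inj₂ na')) (inj₂ sb) (inj₂ sg) = ⊥-elim (¬all-nonPos na' (swap sb) (swap sg))
    go (inj₂ (inj₁ za)) (inj₂ sb) _ = ⊥-elim (na (onSeg-wa za (swap sb)))
    go (inj₂ (inj₁ za)) (inj₁ pb) (inj₂ (inj₂ ng)) = inj₂ (inj₁ (in-bcw pb ng))
    go (inj₂ (inj₁ za)) (inj₁ pb) (inj₁ pg) = ⊥-elim (na (onSeg-wa′ za (inj₁ pg)))
    go (inj₂ (inj₁ za)) (inj₁ pb) (inj₂ (inj₁ zg)) = ⊥-elim (na (onSeg-wa′ za (inj₂ (sym zg))))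

  inTriangle-subdivide : ∀ {a b c q w} → InTriangle a b c q → InTriangle a b c w →
    ¬ OnSeg w a q → ¬ OnSeg w b q → ¬ OnSeg w c q →
    InTriangle a b w q ⊎ (InTriangle b c w q ⊎ InTriangle c a w q)
  inTriangle-subdivide {a} {b} {c} {q} {w} (ccw Q) (ccw W) na nb nc with inCCW-subdivide a b c q w Q W na nb nc
  ... | inj₁ x = inj₁ (ccw x)
  ... | inj₂ (inj₁ x) = inj₂ (inj₁ (ccw x))
  ... | inj₂ (inj₂ x) = inj₂ (inj₂ (ccw x))
  inTriangle-subdivide {a} {b} {c} {q} {w} (cw Q) (cw W) na nb nc with inCCW-subdivide a c b q w Q W na nc nb
  ... | inj₁ x = inj₂ (inj₂ (cw (inCCW-rotate x)))
  ... | inj₂ (inj₁ x) = inj₂ (inj₁ (cw (inCCW-rotate x)))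
  ... | inj₂ (inj₂ x) = inj₁ (cw (inCCW-rotate x))
  inTriangle-subdivide (ccw Q) (cw W) _ _ _ = ⊥-elim (¬inCCW-both-orientations Q W)
  inTriangle-subdivide (cw Q) (ccw W) _ _ _ = ⊥-elim (¬inCCW-both-orientations W Q)

  exit-through-side : ∀ x y z A B → InCCW x y z A → ¬ InCCW x y z B → 0# ≤F det A x B → (det A y B ≤F 0#) →
         Σ Point (λ r → OnSeg A B r × OnSeg x y r)
  exit-through-side x y z A B PA nB sx sy with compare₀ (det x y B)
  ... | inj₁ p = ⊥-elim (nB (inCCW p q2 q3))
    where
    K : 0# < det x y A
    K = InCCW.side₁ PA
    Kz : 0# < det x y z
    Kz = inCCW⇒det-pos PA
    q2 : 0# < det y z B
    q2 = *-pos-cancelˡ K (pos-resp (sym (det-exit₁ x y z A B))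
          (+-pos-nonNeg (*-pos p (InCCW.side₂ PA)) (x≤0⇒0≤-x (*-nonPos-pos sy Kz))))
    q3 : 0# < det z x B
    q3 = *-pos-cancelˡ K (pos-resp (sym (det-exit₂ x y z A B))
          (+-pos-nonNeg (*-pos p (InCCW.side₃ PA)) (*-nonNeg sx (inj₁ Kz))))
  ... | inj₂ d with segments-cross x y A B (InCCW.side₁ PA) (swap d) (negated-nonNeg (det-swap₂₃ A x B) sx)
      (negated-nonPos (det-swap₂₃ A y B) sy)
  ...   | X , s1 , s2 = X , s2 , s1

  exit-through-boundary : ∀ x y z A B → InCCW x y z A → ¬ InCCW x y z B →
       Σ Point (λ r → OnSeg A B r × (OnSeg x y r ⊎ (OnSeg y z r ⊎ OnSeg z x r)))
  exit-through-boundary x y z A B PA nB = go (compare₀ σx) (compare₀ σy) (compare₀ σz)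
    where
    σx σy σz : Carrier
    σx = det A x B
    σy = det A y B
    σz = det A z B
    rel : (((det y z A * σx) + (det z x A * σy)) + (det x y A * σz)) ≈ 0#
    rel = det-syzygy x y z A B
    R : Set _
    R = Σ Point (λ r → OnSeg A B r × (OnSeg x y r ⊎ (OnSeg y z r ⊎ OnSeg z x r)))
    sxy : 0# ≤F σx → (σy ≤F 0#) → R
    sxy p q with exit-through-side x y z A B PA nB p q
    ... | r , s1 , s2 = r , s1 , inj₁ s2
    syz : 0# ≤F σy → (σz ≤F 0#) → R
    syz p q with exit-through-side y z x A B (inCCW-rotate PA) (λ P → nB (inCCW-rotate (inCCW-rotate P))) p q
    ... | r , s1 , s2 = r , s1 , inj₂ (inj₁ s2)
    szx : 0# ≤F σz → (σx ≤F 0#) → R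
    szx p q with exit-through-side z x y A B (inCCW-rotate (inCCW-rotate PA)) (λ P → nB (inCCW-rotate P)) p q
    ... | r , s1 , s2 = r , s1 , inj₂ (inj₂ s2)
    la : 0# < det y z A
    la = InCCW.side₂ PA
    lb : 0# < det z x A
    lb = InCCW.side₃ PA
    lc : 0# < det x y A
    lc = InCCW.side₁ PA
    go : _ → _ → _ → R
    go (inj₁ px) (inj₂ sy) _ = sxy (inj₁ px) (swap sy)
    go (inj₂ (inj₁ zx)) (inj₂ sy) _ = sxy (inj₂ (sym zx)) (swap sy)
    go (inj₁ px) (inj₁ py) (inj₂ sz) = syz (inj₁ py) (swap sz)
    go (inj₂ (inj₁ zx)) (inj₁ py) (inj₂ sz) = syz (inj₁ py) (swap sz)
    go (inj₁ px) (inj₁ py) (inj₁ pz) = ⊥-elim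
        (<⇒≉ (+₃-pos (*-pos la px) (*-nonNeg (inj₁ lb) (inj₁ py)) (*-nonNeg (inj₁ lc) (inj₁ pz))) (sym rel))
    go (inj₂ (inj₁ zx)) (inj₁ py) (inj₁ pz) = ⊥-elim
        (<⇒≉ (+-pos-nonNeg (+-nonNeg-pos (*-nonNeg (inj₁ la) (inj₂ (sym zx))) (*-pos lb py)) (*-nonNeg (inj₁ lc) (inj₁ pz))) (sym rel))
    go (inj₂ (inj₂ nx)) _ (inj₁ pz) = szx (inj₁ pz) (inj₁ nx)
    go (inj₂ (inj₂ nx)) _ (inj₂ (inj₁ zz)) = szx (inj₂ (sym zz)) (inj₁ nx)
    go (inj₂ (inj₂ nx)) (inj₁ py) (inj₂ (inj₂ nz)) = syz (inj₁ py) (inj₁ nz)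
    go (inj₂ (inj₂ nx)) (inj₂ (inj₁ zy)) (inj₂ (inj₂ nz)) = syz (inj₂ (sym zy)) (inj₁ nz)
    go (inj₂ (inj₂ nx)) (inj₂ (inj₂ ny)) (inj₂ (inj₂ nz)) = ⊥-elim
        (<⇒≉ (+₃-neg (*-pos-neg la nx) (*-pos-nonPos lb (inj₁ ny)) (*-pos-nonPos lc (inj₁ nz))) rel)

  exit-triangle : ∀ a b c X Y → InTriangle a b c X → ¬ InTriangle a b c Y →
    Σ Point (λ r → OnSeg X Y r × (OnSeg a b r ⊎ (OnSeg b c r ⊎ OnSeg a c r)))
  exit-triangle a b c X Y (ccw X∈) Y∉ with exit-through-boundary a b c X Y X∈ (λ p → Y∉ (ccw p))
  ... | r , s , inj₁ e        = r , s , inj₁ e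
  ... | r , s , inj₂ (inj₁ e) = r , s , inj₂ (inj₁ e)
  ... | r , s , inj₂ (inj₂ e) = r , s , inj₂ (inj₂ (onSeg-sym c a r e))
  exit-triangle a b c X Y (cw X∈) Y∉ with exit-through-boundary a c b X Y X∈ (λ p → Y∉ (cw p))
  ... | r , s , inj₁ e        = r , s , inj₂ (inj₂ e)
  ... | r , s , inj₂ (inj₁ e) = r , s , inj₂ (inj₁ (onSeg-sym c b r e))
  ... | r , s , inj₂ (inj₂ e) = r , s , inj₁ (onSeg-sym b a r e)

  segment-meets-boundary : ∀ {a b c X Y} →
    (InTriangle a b c X × ¬ InTriangle a b c Y) ⊎ (¬ InTriangle a b c X × InTriangle a b c Y) →
    Σ Point (λ r → OnSeg X Y r × (OnSeg a b r ⊎ (OnSeg b c r ⊎ OnSeg a c r)))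
  segment-meets-boundary (inj₁ (X∈ , Y∉)) = exit-triangle _ _ _ _ _ X∈ Y∉
  segment-meets-boundary {X = X} {Y} (inj₂ (X∉ , Y∈)) with r , r∈YX , side ← exit-triangle _ _ _ _ _ Y∈ X∉ =
    r , onSeg-sym Y X r r∈YX , side

  NoCrossing : Point → Point → Point → Point → Set _
  NoCrossing p q r s = ¬ Σ Point (λ X → OnSeg p q X × OnSeg r s X)

  OneInsideTheOthers : Point → Point → Point → Point → Set _
  OneInsideTheOthers a b c d = InTriangle b c d a ⊎ (InTriangle a c d b ⊎ (InTriangle a b d c ⊎ InTriangle a b c d))

  one-inside-the-others-ccw : ∀ a b c d → 0# < det a b c →
    ¬ (det a b d ≈ 0#) → ¬ (det b c d ≈ 0#) → ¬ (det c a d ≈ 0#) →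
    NoCrossing a b c d → NoCrossing b c a d → NoCrossing c a b d → OneInsideTheOthers a b c d
  one-inside-the-others-ccw a b c d K n1 n2 n3 x1 x2 x3 = go (compare₀ s1) (compare₀ s2) (compare₀ s3)
    where
    s1 s2 s3 : Carrier
    s1 = det a b d
    s2 = det b c d
    s3 = det c a d
    go : _ → _ → _ → OneInsideTheOthers a b c d
    go (inj₂ (inj₁ z)) _ _ = ⊥-elim (n1 z)
    go _ (inj₂ (inj₁ z)) _ = ⊥-elim (n2 z)
    go _ _ (inj₂ (inj₁ z)) = ⊥-elim (n3 z)
    go (inj₁ p₁) (inj₁ p₂) (inj₁ p₃) = inj₂ (inj₂ (inj₂ (ccw (inCCW p₁ p₂ p₃))))
    go (inj₂ (inj₂ m1)) (inj₁ p₂) (inj₁ p₃) =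
      ⊥-elim (x1 (segments-cross a b c d K (inj₁ m1) (negated-nonNeg (det-swap₂₃ c a d) (inj₁ p₃)) (inj₁ (pos-resp (det-rotate b c d) p₂))))
    go (inj₁ p₁) (inj₂ (inj₂ m2)) (inj₁ p₃) =
      ⊥-elim (x2 (segments-cross b c a d (pos-resp (det-rotate a b c) K) (inj₁ m2) (negated-nonNeg (det-swap₂₃ a b d) (inj₁ p₁)) (inj₁ (pos-resp (det-rotate c a d) p₃))))
    go (inj₁ p₁) (inj₁ p₂) (inj₂ (inj₂ m3)) =
      ⊥-elim (x3 (segments-cross c a b d (pos-resp (det-rotate² a b c) K) (inj₁ m3) (negated-nonNeg (det-swap₂₃ b c d) (inj₁ p₂)) (inj₁ (pos-resp (det-rotate a b d) p₁))))
    go (inj₂ (inj₂ m1)) (inj₂ (inj₂ m2)) (inj₁ p₃) =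
      inj₂ (inj₁ (cw (inCCW (negated-pos (det-swap₂₃ a b d) m1) (negated-pos (det-swap₁₃ b c d) m2) (pos-resp (det-rotate² a b c) K))))
    go (inj₁ p₁) (inj₂ (inj₂ m2)) (inj₂ (inj₂ m3)) =
      inj₂ (inj₂ (inj₁ (ccw (inCCW K (negated-pos (det-swap₂₃ b c d) m2) (negated-pos (det-swap₁₃ c a d) m3)))))
    go (inj₂ (inj₂ m1)) (inj₁ p₂) (inj₂ (inj₂ m3)) =
      inj₁ (ccw (inCCW (pos-resp (det-rotate a b c) K) (negated-pos (det-swap₂₃ c a d) m3) (negated-pos (det-swap₁₃ a b d) m1)))
    go (inj₂ (inj₂ m1)) (inj₂ (inj₂ m2)) (inj₂ (inj₂ m3)) =
      ⊥-elim (<-asym K (neg-resp (sym (det-split a b c d)) (+-neg-nonPos (+-neg-nonPos m1 (inj₁ m2)) (inj₁ m3))))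

  inTriangle-swap₂₃ : ∀ {a b c q} → InTriangle a c b q → InTriangle a b c q
  inTriangle-swap₂₃ (ccw p) = cw p
  inTriangle-swap₂₃ (cw p) = ccw p

  noCrossing-sym : ∀ {p q r s} → NoCrossing p q r s → NoCrossing q p r s
  noCrossing-sym {p} {q} n (X , s1 , s2) = n (X , onSeg-sym q p X s1 , s2)

  negated-nonzero : ∀ {X Y} → X ≈ - Y → ¬ (Y ≈ 0#) → ¬ (X ≈ 0#)
  negated-nonzero e n z = n (negated-zero e z)

  one-inside-the-others : ∀ a b c d → ¬ (det a b c ≈ 0#) →
    ¬ (det a b d ≈ 0#) → ¬ (det b c d ≈ 0#) → ¬ (det c a d ≈ 0#) →
    NoCrossing a b c d → NoCrossing b c a d → NoCrossing c a b d → OneInsideTheOthers a b c d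
  one-inside-the-others a b c d n0 n1 n2 n3 x1 x2 x3 with compare₀ (det a b c)
  ... | inj₁ K = one-inside-the-others-ccw a b c d K n1 n2 n3 x1 x2 x3
  ... | inj₂ (inj₁ z) = ⊥-elim (n0 z)
  ... | inj₂ (inj₂ m) with one-inside-the-others-ccw a c b d (negated-pos (det-swap₂₃ a b c) m)
        (negated-nonzero (trans (det-rotate a c d) (det-swap₂₃ c a d)) n3)
        (negated-nonzero (det-swap₁₂ b c d) n2)
        (negated-nonzero (det-swap₁₂ a b d) n1)
        (noCrossing-sym x3)
        (noCrossing-sym x2)
        (noCrossing-sym x1)
  ...   | inj₁ i = inj₁ (inTriangle-swap₁₂ i)
  ...   | inj₂ (inj₁ i) = inj₂ (inj₂ (inj₁ i))
  ...   | inj₂ (inj₂ (inj₁ i)) = inj₂ (inj₁ i)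
  ...   | inj₂ (inj₂ (inj₂ i)) = inj₂ (inj₂ (inj₂ (inTriangle-swap₂₃ i)))



module Stacking where

  open import Data.Nat as ℕ using (ℕ; zero; suc; z≤n; s≤s)
  import Data.Nat.Properties as ℕ
  open import Data.Bool using (Bool; true; false; _∨_)
  open import Data.Fin as Fin using (Fin; zero; suc; inject₁; inject≤; fromℕ; _≟_)
  import Data.Fin.Properties as Fin
  open import Data.Vec using (Vec; []; _∷_; lookup; tabulate; zipWith; allFin; _∷ʳ_)
  import Data.Vec.Properties as Vec
  open import Data.List using (List; []; _∷_; _++_; map)
  open import Data.List.Relation.Unary.Any using (here; there; _─_)
  open import Data.List.Membership.Propositional using (_∈_)
  open import Data.List.Membership.Propositional.Properties using (∈-map⁻; ∈-++⁻)
  open import Data.Product using (Σ; ∃; _×_; _,_; proj₁; proj₂)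
  open import Data.Product.Properties using (≡-dec)
  open import Data.Sum using (_⊎_; inj₁; inj₂)
  open import Data.Empty using (⊥-elim)
  open import Relation.Nullary using (¬_; Dec; yes; no)
  open import Relation.Nullary.Decidable using (⌊_⌋)
  open import Relation.Binary.PropositionalEquality using (_≡_; _≢_; refl; sym; trans; cong)

  lookup-∷ʳ-inject₁ : ∀ {A : Set} {n} (xs : Vec A n) x (i : Fin n) → lookup (xs ∷ʳ x) (inject₁ i) ≡ lookup xs i
  lookup-∷ʳ-inject₁ (y ∷ ys) x zero    = refl
  lookup-∷ʳ-inject₁ (y ∷ ys) x (suc i) = lookup-∷ʳ-inject₁ ys x i

  lookup-∷ʳ-fromℕ : ∀ {A : Set} {n} (xs : Vec A n) x → lookup (xs ∷ʳ x) (fromℕ n) ≡ x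
  lookup-∷ʳ-fromℕ []       x = refl
  lookup-∷ʳ-fromℕ (y ∷ ys) x = lookup-∷ʳ-fromℕ ys x

  inject₁-or-fromℕ : ∀ {n} (v : Fin (suc n)) → (∃ λ a → v ≡ inject₁ a) ⊎ (v ≡ fromℕ n)
  inject₁-or-fromℕ {zero}  zero    = inj₂ refl
  inject₁-or-fromℕ {suc n} zero    = inj₁ (zero , refl)
  inject₁-or-fromℕ {suc n} (suc v) with inject₁-or-fromℕ v
  ... | inj₁ (a , e) = inj₁ (suc a , cong suc e)
  ... | inj₂ e       = inj₂ (cong suc e)

  inject₁≢fromℕ : ∀ {n} {a : Fin n} → inject₁ a ≢ fromℕ n
  inject₁≢fromℕ e = Fin.fromℕ≢inject₁ (sym e)

  inject₁-mono-< : ∀ {n} {a b : Fin n} → a Fin.< b → inject₁ a Fin.< inject₁ b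
  inject₁-mono-< {a = a} {b} p rewrite Fin.toℕ-inject₁ a | Fin.toℕ-inject₁ b = p

  inject₁<fromℕ : ∀ {n} (a : Fin n) → inject₁ a Fin.< fromℕ n
  inject₁<fromℕ {n} a rewrite Fin.toℕ-inject₁ a | Fin.toℕ-fromℕ n = Fin.toℕ<n a

  ∈-─⁻ : ∀ {A : Set} {x y : A} {xs} (p : x ∈ xs) → y ∈ (xs ─ p) → y ∈ xs
  ∈-─⁻ (here _)  q         = there q
  ∈-─⁻ (there p) (here e)  = here e
  ∈-─⁻ (there p) (there q) = there (∈-─⁻ p q)

  ∈-─⁺ : ∀ {A : Set} {x y : A} {xs} (p : x ∈ xs) → y ∈ xs → y ≢ x → y ∈ (xs ─ p)
  ∈-─⁺ (here refl) (here refl) y≢x = ⊥-elim (y≢x refl)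
  ∈-─⁺ (here _)    (there q)   _   = q
  ∈-─⁺ (there p)   (here e)    _   = here e
  ∈-─⁺ (there p)   (there q)   y≢x = there (∈-─⁺ p q y≢x)

  OneOf₃ : ∀ {n} → Fin n → Fin n → Fin n → Fin n → Set
  OneOf₃ i j k a = (a ≡ i) ⊎ ((a ≡ j) ⊎ (a ≡ k))

  Corner : ∀ {n} → Triangle n → Fin n → Set
  Corner (i , j , k) = OneOf₃ i j k

  NotCorner : ∀ {n} → Triangle n → Fin n → Set
  NotCorner (i , j , k) v = (v ≢ i) × (v ≢ j) × (v ≢ k)

  notCorner? : ∀ {n} (f : Triangle n) v → Dec (NotCorner f v)
  notCorner? (i , j , k) v with v ≟ i | v ≟ j | v ≟ k
  ... | no a  | no b  | no c  = yes (a , b , c)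
  ... | yes e | _     | _     = no (λ z → proj₁ z e)
  ... | no _  | yes e | _     = no (λ z → proj₁ (proj₂ z) e)
  ... | no _  | no _  | yes e = no (λ z → proj₂ (proj₂ z) e)

  ¬notCorner⇒corner : ∀ {n} (f : Triangle n) v → ¬ NotCorner f v → Corner f v
  ¬notCorner⇒corner (i , j , k) v ¬nc with v ≟ i | v ≟ j | v ≟ k
  ... | yes e | _     | _     = inj₁ e
  ... | no _  | yes e | _     = inj₂ (inj₁ e)
  ... | no _  | no _  | yes e = inj₂ (inj₂ e)
  ... | no a  | no b  | no c  = ⊥-elim (¬nc (a , b , c))

  triangle-≟ : ∀ {n} (f g : Triangle n) → Dec (f ≡ g)
  triangle-≟ = ≡-dec _≟_ (≡-dec _≟_ _≟_)

  corner-position : ∀ {n} {a b c v : Fin n} → OneOf₃ a b c v → Fin 3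
  corner-position (inj₁ _)        = zero
  corner-position (inj₂ (inj₁ _)) = suc zero
  corner-position (inj₂ (inj₂ _)) = suc (suc zero)

  lookup-corner-position : ∀ {n} {a b c v : Fin n} (m : OneOf₃ a b c v) → lookup (a ∷ b ∷ c ∷ []) (corner-position m) ≡ v
  lookup-corner-position (inj₁ e)        = sym e
  lookup-corner-position (inj₂ (inj₁ e)) = sym e
  lookup-corner-position (inj₂ (inj₂ e)) = sym e

  -- If four vertices were corners, two would share a position (pigeonhole).
  missing-corner : ∀ {n} → 4 ℕ.≤ n → (f : Triangle n) → Σ (Fin n) (NotCorner f)
  missing-corner 4≤n f@(a , b , c) with Fin.any? (λ i → notCorner? f (inject≤ i 4≤n))
  ... | yes (i , nc) = inject≤ i 4≤n , nc
  ... | no none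
    with corner ← (λ i → ¬notCorner⇒corner f (inject≤ i 4≤n) (λ nc → none (i , nc)))
    with i , j , i<j , same ← Fin.pigeonhole (s≤s ℕ.≤-refl) (λ i → corner-position (corner i))
    = ⊥-elim (Fin.<⇒≢ i<j (Fin.inject≤-injective 4≤n 4≤n i j
        (trans (sym (lookup-corner-position (corner i)))
          (trans (cong (lookup (a ∷ b ∷ c ∷ [])) same) (lookup-corner-position (corner j))))))

  Sorted : ∀ {n} → Triangle n → Set
  Sorted (a , b , c) = (a Fin.< b) × (b Fin.< c)

  oneOf₃-below : ∀ {n} {g₁ g₂ g₃ x : Fin n} → Sorted (g₁ , g₂ , g₃) → OneOf₃ g₁ g₂ g₃ x → x Fin.< g₂ → x ≡ g₁
  oneOf₃-below _           (inj₁ e)           _    = e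
  oneOf₃-below _           (inj₂ (inj₁ refl)) x<g₂ = ⊥-elim (Fin.<-irrefl refl x<g₂)
  oneOf₃-below (_ , g₂<g₃) (inj₂ (inj₂ refl)) x<g₂ = ⊥-elim (Fin.<-asym x<g₂ g₂<g₃)

  oneOf₃-above : ∀ {n} {g₁ g₂ g₃ x : Fin n} → Sorted (g₁ , g₂ , g₃) → OneOf₃ g₁ g₂ g₃ x → g₂ Fin.< x → x ≡ g₃
  oneOf₃-above (g₁<g₂ , _) (inj₁ refl)        g₂<x = ⊥-elim (Fin.<-asym g₁<g₂ g₂<x)
  oneOf₃-above _           (inj₂ (inj₁ refl)) g₂<x = ⊥-elim (Fin.<-irrefl refl g₂<x)
  oneOf₃-above _           (inj₂ (inj₂ e))    _    = e

  sorted-corners-unique : ∀ {n} {g₁ g₂ g₃ i j k : Fin n} → Sorted (g₁ , g₂ , g₃) → Sorted (i , j , k) →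
    OneOf₃ g₁ g₂ g₃ i → OneOf₃ g₁ g₂ g₃ j → OneOf₃ g₁ g₂ g₃ k → (i , j , k) ≡ (g₁ , g₂ , g₃)
  sorted-corners-unique sg@(g₁<g₂ , g₂<g₃) (i<j , j<k) ∈i ∈j ∈k with ∈j
  ... | inj₁ refl        = ⊥-elim (Fin.<⇒≢ i<j (oneOf₃-below sg ∈i (Fin.<-trans i<j g₁<g₂)))
  ... | inj₂ (inj₂ refl) = ⊥-elim (Fin.<⇒≢ j<k (sym (oneOf₃-above sg ∈k (Fin.<-trans g₂<g₃ j<k))))
  ... | inj₂ (inj₁ refl) rewrite oneOf₃-below sg ∈i i<j | oneOf₃-above sg ∈k j<k = refl

  corner-outside : ∀ {n} (g : Triangle n) {i j k} → Sorted g → Sorted (i , j , k) → g ≢ (i , j , k) →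
    Σ (Fin n) (λ l → OneOf₃ i j k l × NotCorner g l)
  corner-outside g {i} {j} {k} sg sf g≢f with notCorner? g i | notCorner? g j | notCorner? g k
  ... | yes p | _     | _     = i , inj₁ refl , p
  ... | no _  | yes p | _     = j , inj₂ (inj₁ refl) , p
  ... | no _  | no _  | yes p = k , inj₂ (inj₂ refl) , p
  ... | no a  | no b  | no c  =
    ⊥-elim (g≢f (sym (sorted-corners-unique sg sf (¬notCorner⇒corner g i a) (¬notCorner⇒corner g j b) (¬notCorner⇒corner g k c))))

  incident? : ∀ {n} → Fin n → Fin n → Fin n → Fin n → Bool
  incident? i j k a = ⌊ a ≟ i ⌋ ∨ ⌊ a ≟ j ⌋ ∨ ⌊ a ≟ k ⌋

  incident?⇒oneOf₃ : ∀ {n} (i j k a : Fin n) → incident? i j k a ≡ true → OneOf₃ i j k a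
  incident?⇒oneOf₃ i j k a e with a ≟ i | a ≟ j | a ≟ k
  ... | yes p | _     | _     = inj₁ p
  ... | no _  | yes p | _     = inj₂ (inj₁ p)
  ... | no _  | no _  | yes p = inj₂ (inj₂ p)
  ... | no _  | no _  | no _  with () ← e

  oneOf₃⇒incident? : ∀ {n} (i j k a : Fin n) → OneOf₃ i j k a → incident? i j k a ≡ true
  oneOf₃⇒incident? i j k a m with a ≟ i | a ≟ j | a ≟ k | m
  ... | yes _ | _     | _     | _              = refl
  ... | no _  | yes _ | _     | _              = refl
  ... | no _  | no _  | yes _ | _              = refl
  ... | no p  | no _  | no _  | inj₁ e         = ⊥-elim (p e)
  ... | no _  | no q  | no _  | inj₂ (inj₁ e) = ⊥-elim (q e)
  ... | no _  | no _  | no r  | inj₂ (inj₂ e) = ⊥-elim (r e)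

  lookup-extend-inject₁ : ∀ {n} (G : Graph n) i j k a →
    lookup (extend G i j k) (inject₁ a) ≡ lookup G a ∷ʳ incident? i j k a
  lookup-extend-inject₁ {n} G i j k a
    rewrite lookup-∷ʳ-inject₁ (zipWith (λ a row → row ∷ʳ incident? i j k a) (allFin n) G)
        (tabulate (incident? i j k) ∷ʳ false) a
          | Vec.lookup-zipWith (λ a row → row ∷ʳ incident? i j k a) a (allFin n) G
          | Vec.lookup-allFin a = refl

  lookup-extend-fromℕ : ∀ {n} (G : Graph n) i j k → lookup (extend G i j k) (fromℕ n) ≡ tabulate (incident? i j k) ∷ʳ false
  lookup-extend-fromℕ {n} G i j k = lookup-∷ʳ-fromℕ (zipWith (λ a row → row ∷ʳ incident? i j k a) (allFin n) G) _

  module Extend {n} (G : Graph n) (i j k : Fin n) where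

    G⁺ : Graph (suc n)
    G⁺ = extend G i j k

    new : Fin (suc n)
    new = fromℕ n

    adj-old⁺ : ∀ {a b} → Adj G a b → Adj G⁺ (inject₁ a) (inject₁ b)
    adj-old⁺ {a} {b} e rewrite lookup-extend-inject₁ G i j k a | lookup-∷ʳ-inject₁ (lookup G a) (incident? i j k a) b = e

    adj-old-new⁺ : ∀ {a} → OneOf₃ i j k a → Adj G⁺ (inject₁ a) new
    adj-old-new⁺ {a} m rewrite lookup-extend-inject₁ G i j k a | lookup-∷ʳ-fromℕ (lookup G a) (incident? i j k a) =
      oneOf₃⇒incident? i j k a m

    adj-new-old⁺ : ∀ {a} → OneOf₃ i j k a → Adj G⁺ new (inject₁ a)
    adj-new-old⁺ {a} m
      rewrite lookup-extend-fromℕ G i j k | lookup-∷ʳ-inject₁ (tabulate (incident? i j k)) false a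
            | Vec.lookup∘tabulate (incident? i j k) a = oneOf₃⇒incident? i j k a m

  extend-injectiveˡ : ∀ {n} {G G′ : Graph n} {i j k i′ j′ k′} → extend G i j k ≡ extend G′ i′ j′ k′ → G ≡ G′
  extend-injectiveˡ {G = G} {G′} {i} {j} {k} {i′} {j′} {k′} e =
    trans (sym (Vec.tabulate∘lookup G)) (trans (Vec.tabulate-cong same-row) (Vec.tabulate∘lookup G′))
    where
    same-row : ∀ a → lookup G a ≡ lookup G′ a
    same-row a = Vec.∷ʳ-injectiveˡ _ _
      (trans (sym (lookup-extend-inject₁ G i j k a)) (trans (cong (λ H → lookup H (inject₁ a)) e) (lookup-extend-inject₁ G′ i′ j′ k′ a)))

  extend-injectiveʳ : ∀ {n} {G G′ : Graph n} {i j k i′ j′ k′} → Sorted (i , j , k) → Sorted (i′ , j′ , k′) →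
    extend G i j k ≡ extend G′ i′ j′ k′ → (i , j , k) ≡ (i′ , j′ , k′)
  extend-injectiveʳ {n} {G} {G′} {i} {j} {k} {i′} {j′} {k′} s s′ e =
    sorted-corners-unique s′ s (corner (inj₁ refl)) (corner (inj₂ (inj₁ refl))) (corner (inj₂ (inj₂ refl)))
    where
    last-row : tabulate (incident? i j k) ∷ʳ false ≡ tabulate (incident? i′ j′ k′) ∷ʳ false
    last-row = trans (sym (lookup-extend-fromℕ G i j k))
        (trans (cong (λ H → lookup H (fromℕ n)) e) (lookup-extend-fromℕ G′ i′ j′ k′))
    same-incidence : ∀ a → incident? i j k a ≡ incident? i′ j′ k′ a
    same-incidence a = trans (sym (Vec.lookup∘tabulate (incident? i j k) a))
      (trans (cong (λ r → lookup r a) (Vec.∷ʳ-injectiveˡ _ _ last-row)) (Vec.lookup∘tabulate (incident? i′ j′ k′) a))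
    corner : ∀ {a} → OneOf₃ i j k a → OneOf₃ i′ j′ k′ a
    corner {a} m = incident?⇒oneOf₃ i′ j′ k′ a (trans (sym (same-incidence a)) (oneOf₃⇒incident? i j k a m))

  FaceEdges : ∀ {n} → Graph n → Triangle n → Set
  FaceEdges G (a , b , c) = Adj G a b × Adj G b c × Adj G a c

  newFaces : ∀ {n} → Fin n → Fin n → Fin n → List (Triangle (suc n))
  newFaces {n} i j k =
    (inject₁ i , inject₁ j , fromℕ n) ∷ (inject₁ j , inject₁ k , fromℕ n) ∷ (inject₁ i , inject₁ k , fromℕ n) ∷ []

  ∈-faces⁻ : ∀ {n} {F : List (Triangle n)} {i j k} (m : (i , j , k) ∈ F) {h} →
    h ∈ (map liftT (F ─ m) ++ newFaces i j k) →
    (∃ λ g → (g ∈ (F ─ m)) × (h ≡ liftT g)) ⊎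
    ((h ≡ (inject₁ i , inject₁ j , fromℕ n)) ⊎ ((h ≡ (inject₁ j , inject₁ k , fromℕ n)) ⊎ (h ≡ (inject₁ i , inject₁ k , fromℕ n))))
  ∈-faces⁻ {F = F} m h∈ with ∈-++⁻ (map liftT (F ─ m)) h∈
  ... | inj₁ p with g , g∈ , e ← ∈-map⁻ liftT p = inj₁ (g , g∈ , e)
  ∈-faces⁻ m h∈ | inj₂ (here e)                 = inj₂ (inj₁ e)
  ∈-faces⁻ m h∈ | inj₂ (there (here e))         = inj₂ (inj₂ (inj₁ e))
  ∈-faces⁻ m h∈ | inj₂ (there (there (here e))) = inj₂ (inj₂ (inj₂ e))

  record WellFormed (n : ℕ) (G : Graph n) (F : List (Triangle n)) : Set where
    field
      4≤n    : 4 ℕ.≤ n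
      sorted : ∀ {f} → f ∈ F → Sorted f
      edges  : ∀ {f} → f ∈ F → FaceEdges G f

  wellFormed-K4 : WellFormed 4 K4 K4faces
  wellFormed-K4 = record { 4≤n = ℕ.≤-refl ; sorted = sorted ; edges = edges }
    where
    sorted : ∀ {f} → f ∈ K4faces → Sorted f
    sorted (here refl)                         = s≤s z≤n , s≤s (s≤s z≤n)
    sorted (there (here refl))                 = s≤s z≤n , s≤s (s≤s z≤n)
    sorted (there (there (here refl)))         = s≤s z≤n , s≤s (s≤s (s≤s z≤n))
    sorted (there (there (there (here refl)))) = s≤s (s≤s z≤n) , s≤s (s≤s (s≤s z≤n))
    edges : ∀ {f} → f ∈ K4faces → FaceEdges K4 f
    edges (here refl)                         = refl , refl , refl
    edges (there (here refl))                 = refl , refl , refl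
    edges (there (there (here refl)))         = refl , refl , refl
    edges (there (there (there (here refl)))) = refl , refl , refl

  wellFormed-step : ∀ {n G F} → WellFormed n G F → ∀ i j k (m : (i , j , k) ∈ F) →
    WellFormed (suc n) (extend G i j k) (map liftT (F ─ m) ++ newFaces i j k)
  wellFormed-step {n} {G} {F} wf i j k m = record { 4≤n = ℕ.m≤n⇒m≤1+n (WellFormed.4≤n wf) ; sorted = sorted ; edges = edges }
    where
    open Extend G i j k
    i<j<k = WellFormed.sorted wf m
    ijk-edges = WellFormed.edges wf m
    sorted : ∀ {f} → f ∈ _ → Sorted f
    sorted h∈ with ∈-faces⁻ m h∈
    ... | inj₁ (_ , g∈ , refl) with p , q ← WellFormed.sorted wf (∈-─⁻ m g∈) = inject₁-mono-< p , inject₁-mono-< q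
    sorted h∈ | inj₂ (inj₁ refl)        = inject₁-mono-< (proj₁ i<j<k) , inject₁<fromℕ j
    sorted h∈ | inj₂ (inj₂ (inj₁ refl)) = inject₁-mono-< (proj₂ i<j<k) , inject₁<fromℕ k
    sorted h∈ | inj₂ (inj₂ (inj₂ refl)) = inject₁-mono-< (Fin.<-trans (proj₁ i<j<k) (proj₂ i<j<k)) , inject₁<fromℕ k
    edges : ∀ {f} → f ∈ _ → FaceEdges G⁺ f
    edges h∈ with ∈-faces⁻ m h∈
    ... | inj₁ (_ , g∈ , refl) with p , q , r ← WellFormed.edges wf (∈-─⁻ m g∈) = adj-old⁺ p , adj-old⁺ q , adj-old⁺ r
    edges h∈ | inj₂ (inj₁ refl) =
      adj-old⁺ (proj₁ ijk-edges) , adj-old-new⁺ (inj₂ (inj₁ refl)) , adj-old-new⁺ (inj₁ refl)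
    edges h∈ | inj₂ (inj₂ (inj₁ refl)) =
      adj-old⁺ (proj₁ (proj₂ ijk-edges)) , adj-old-new⁺ (inj₂ (inj₂ refl)) , adj-old-new⁺ (inj₂ (inj₁ refl))
    edges h∈ | inj₂ (inj₂ (inj₂ refl)) =
      adj-old⁺ (proj₂ (proj₂ ijk-edges)) , adj-old-new⁺ (inj₂ (inj₂ refl)) , adj-old-new⁺ (inj₁ refl)

  wellFormed : ∀ {n G F} → Stacked n G F → WellFormed n G F
  wellFormed base             = wellFormed-K4
  wellFormed (step s i j k m) = wellFormed-step (wellFormed s) i j k m

module ListCounting where

  open import Data.Nat as ℕ using (ℕ; suc; z≤n; s≤s; _+_; _*_)
  open import Data.List using (List; []; _∷_; map; length; concat)
  import Data.List.Properties as List
  open import Data.List.Relation.Unary.Any using (here; there; _─_; index)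
  open import Data.List.Relation.Unary.All as All using (All; []; _∷_)
  import Data.List.Relation.Unary.All.Properties as All
  open import Data.List.Relation.Unary.AllPairs using ([]; _∷_)
  open import Data.List.Membership.Propositional using (_∈_; mapWith∈)
  open import Data.List.Relation.Unary.Unique.Propositional using (Unique)
  open import Relation.Binary.PropositionalEquality using (_≡_; refl; sym; trans; cong₂; subst)
  open Stacking using (∈-─⁺)

  unique-⊆⇒length≤ : ∀ {A : Set} {xs ys : List A} → Unique xs → (∀ {x} → x ∈ xs → x ∈ ys) → length xs ℕ.≤ length ys
  unique-⊆⇒length≤ {xs = []}     _          _   = z≤n
  unique-⊆⇒length≤ {xs = x ∷ xs} {ys} (x∉xs ∷ u) xs⊆ys =
    subst (suc (length xs) ℕ.≤_) (sym (List.length-removeAt′ ys (index x∈ys)))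
      (s≤s (unique-⊆⇒length≤ u (λ q → ∈-─⁺ x∈ys (xs⊆ys (there q)) (λ e → All.lookup x∉xs q (sym e)))))
    where
    x∈ys = xs⊆ys (here refl)

  unique-─ : ∀ {A : Set} {x : A} {xs} → Unique xs → (p : x ∈ xs) → Unique (xs ─ p)
  unique-─ (_ ∷ u)     (here _)  = u
  unique-─ (x∉xs ∷ u) (there p) = All.─⁺ p x∉xs ∷ unique-─ u p

  mapWith∈-all : ∀ {A B : Set} {P : B → Set} (xs : List A) (f : ∀ {x} → x ∈ xs → B) →
    (∀ {x} (p : x ∈ xs) → P (f p)) → All P (mapWith∈ xs f)
  mapWith∈-all []       f h = []
  mapWith∈-all (x ∷ xs) f h = h (here refl) ∷ mapWith∈-all xs (λ p → f (there p)) (λ q → h (there q))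

  mapWith∈-unique : ∀ {A B : Set} (xs : List A) (f : ∀ {x} → x ∈ xs → B) → Unique xs →
    (∀ {x y} (p : x ∈ xs) (q : y ∈ xs) → f p ≡ f q → x ≡ y) → Unique (mapWith∈ xs f)
  mapWith∈-unique []       f _          _   = []
  mapWith∈-unique (x ∷ xs) f (x∉xs ∷ u) inj =
    mapWith∈-all xs (λ p → f (there p)) (λ q e → All.lookup x∉xs q (inj (here refl) (there q) e))
    ∷ mapWith∈-unique xs (λ p → f (there p)) u (λ p q → inj (there p) (there q))

  length-concat-map : ∀ {A B : Set} (f : A → List B) (xs : List A) (c : ℕ) →
    (∀ {x} → x ∈ xs → length (f x) ≡ c) → length (concat (map f xs)) ≡ length xs * c
  length-concat-map f []       c h = refl
  length-concat-map f (x ∷ xs) c h =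
    trans (List.length-++ (f x)) (cong₂ _+_ (h (here refl)) (length-concat-map f xs c (λ p → h (there p))))

  length-concat-mapWith∈ : ∀ {A B : Set} (xs : List A) (g : ∀ {x} → x ∈ xs → List B) (c : ℕ) →
    (∀ {x} (p : x ∈ xs) → length (g p) ≡ c) → length (concat (mapWith∈ xs g)) ≡ length xs * c
  length-concat-mapWith∈ []       g c h = refl
  length-concat-mapWith∈ (x ∷ xs) g c h = trans (List.length-++ (g (here refl)))
    (cong₂ _+_ (h (here refl)) (length-concat-mapWith∈ xs (λ p → g (there p)) c (λ p → h (there p))))

module StackedCount where

  open import Data.Nat as ℕ using (ℕ; zero; suc; _+_; _*_; _^_; _!)
  import Data.Nat.Properties as ℕ
  import Data.Fin.Properties as Fin
  open import Data.List using (List; []; _∷_; _++_; map; length; concat)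
  import Data.List.Properties as List
  open import Data.List.Relation.Unary.Any using (here; there; _─_; index)
  open import Data.List.Relation.Unary.All as All using ([]; _∷_)
  open import Data.List.Relation.Unary.AllPairs using ([]; _∷_)
  open import Data.List.Membership.Propositional using (_∈_; mapWith∈)
  open import Data.List.Membership.Propositional.Properties using (∈-map⁻; ∈-map⁺; ∈-++⁻; map-mapWith∈)
  open import Data.List.Relation.Unary.Any.Properties using (mapWith∈⁻)
  open import Data.List.Relation.Unary.Unique.Propositional using (Unique)
  import Data.List.Relation.Unary.Unique.Propositional.Properties as Unique
  open import Data.List.Membership.Setoid.Properties using (length-mapWith∈)
  open import Data.Product using (Σ; ∃; _×_; _,_; proj₁; proj₂)
  open import Data.Sum using (inj₁; inj₂)
  open import Relation.Nullary using (¬_)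
  open import Relation.Binary.PropositionalEquality as ≡ using (_≡_; _≢_; refl; sym; trans; cong; subst)
  open import Function using (_∘_)
  open import Function.Bundles using (Equivalence)
  open Stacking
  open ListCounting

  liftT-injective : ∀ {n} {x y : Triangle n} → liftT x ≡ liftT y → x ≡ y
  liftT-injective {x = x₁ , x₂ , x₃} {y₁ , y₂ , y₃} e
    with refl ← Fin.inject₁-injective (cong proj₁ e)
       | refl ← Fin.inject₁-injective (cong (proj₁ ∘ proj₂) e)
       | refl ← Fin.inject₁-injective (cong (proj₂ ∘ proj₂) e) = refl

  faces-unique : ∀ {n G F} → Stacked n G F → Unique F
  faces-unique base = ((λ ()) ∷ (λ ()) ∷ (λ ()) ∷ []) ∷ ((λ ()) ∷ (λ ()) ∷ []) ∷ ((λ ()) ∷ []) ∷ [] ∷ []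
  faces-unique {suc n} (step {F = F} s i j k m) =
    Unique.++⁺ (Unique.map⁺ liftT-injective (unique-─ (faces-unique s) m)) new-unique old∩new
    where
    i<j<k = WellFormed.sorted (wellFormed s) m
    i≢j : i ≢ j
    i≢j = Fin.<⇒≢ (proj₁ i<j<k)
    j≢k : j ≢ k
    j≢k = Fin.<⇒≢ (proj₂ i<j<k)
    new-unique : Unique (newFaces i j k)
    new-unique =
        ((λ e → i≢j (Fin.inject₁-injective (cong proj₁ e))) ∷ (λ e → j≢k (Fin.inject₁-injective (cong (proj₁ ∘ proj₂) e))) ∷ [])
               ∷ ((λ e → i≢j (sym (Fin.inject₁-injective (cong proj₁ e)))) ∷ []) ∷ [] ∷ []
    old∩new : ∀ {v} → ¬ (v ∈ map liftT (F ─ m) × v ∈ newFaces i j k)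
    old∩new (old , new) with _ , _ , refl ← ∈-map⁻ liftT old with new
    ... | here e                 = Fin.fromℕ≢inject₁ (sym (cong (proj₂ ∘ proj₂) e))
    ... | there (here e)         = Fin.fromℕ≢inject₁ (sym (cong (proj₂ ∘ proj₂) e))
    ... | there (there (here e)) = Fin.fromℕ≢inject₁ (sym (cong (proj₂ ∘ proj₂) e))

  faces-length : ∀ {n G F} → Stacked n G F → 4 + length F ≡ n + n
  faces-length base = refl
  faces-length {suc n} (step {F = F} s i j k m) = begin
    4 + length (map liftT (F ─ m) ++ newFaces i j k) ≡⟨ cong (4 +_) (List.length-++ (map liftT (F ─ m))) ⟩
    4 + (length (map liftT (F ─ m)) + 3)             ≡⟨ cong (λ z → 4 + (z + 3)) (List.length-map liftT (F ─ m)) ⟩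
    4 + (length (F ─ m) + 3)                         ≡⟨ solve 1
        (λ l → con 4 :+ (l :+ con 3) := (con 4 :+ (con 1 :+ l)) :+ con 2) refl (length (F ─ m)) ⟩
    (4 + suc (length (F ─ m))) + 2                   ≡⟨ cong (λ z → (4 + z) + 2) (sym (List.length-removeAt′ F (index m))) ⟩
    (4 + length F) + 2                               ≡⟨ cong (_+ 2) (faces-length s) ⟩
    (n + n) + 2                                      ≡⟨ solve 1
        (λ n → (n :+ n) :+ con 2 := (con 1 :+ n) :+ (con 1 :+ n)) refl n ⟩
    suc n + suc n                                    ∎
    where
    open ≡.≡-Reasoning
    open import Data.Nat.Solver using (module +-*-Solver)
    open +-*-Solver

  StackedTriangulation : ℕ → Set
  StackedTriangulation n = Σ (Graph n) λ G → Σ (List (Triangle n)) (Stacked n G)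

  children : ∀ {n} → StackedTriangulation n → List (StackedTriangulation (suc n))
  children (G , F , s) = mapWith∈ F λ {(i , j , k)} m → extend G i j k , _ , step s i j k m

  allStacked : ∀ d → List (StackedTriangulation (4 + d))
  allStacked zero    = (K4 , K4faces , base) ∷ []
  allStacked (suc d) = concat (map children (allStacked d))

  ∈-children⁻ : ∀ {n} (T : StackedTriangulation n) {H} → H ∈ map proj₁ (children T) →
    ∃ λ f → (f ∈ proj₁ (proj₂ T)) × (H ≡ extend (proj₁ T) (proj₁ f) (proj₁ (proj₂ f)) (proj₂ (proj₂ f)))
  ∈-children⁻ (G , F , s) H∈ with _ , c∈ , refl ← ∈-map⁻ proj₁ H∈ with f , f∈ , refl ← mapWith∈⁻ F _ c∈ = f , f∈ , refl

  ∈-concat-children⁻ : ∀ {n} (Ts : List (StackedTriangulation n)) {H} → H ∈ map proj₁ (concat (map children Ts)) →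
    ∃ λ T → (T ∈ Ts) × (H ∈ map proj₁ (children T))
  ∈-concat-children⁻ (T ∷ Ts) H∈ rewrite List.map-++ proj₁ (children T) (concat (map children Ts))
    with ∈-++⁻ (map proj₁ (children T)) H∈
  ... | inj₁ p = T , here refl , p
  ... | inj₂ p with T′ , T′∈ , q ← ∈-concat-children⁻ Ts p = T′ , there T′∈ , q

  children-distinct : ∀ {n} (T : StackedTriangulation n) → Unique (map proj₁ (children T))
  children-distinct (G , F , s) = subst Unique (sym (map-mapWith∈ F _ proj₁))
    (mapWith∈-unique F _ (faces-unique s)
      (λ p q e → extend-injectiveʳ (WellFormed.sorted (wellFormed s) p) (WellFormed.sorted (wellFormed s) q) e))

  concat-children-distinct : ∀ {n} (Ts : List (StackedTriangulation n)) → Unique (map proj₁ Ts) →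
    Unique (map proj₁ (concat (map children Ts)))
  concat-children-distinct []       _            = []
  concat-children-distinct (T ∷ Ts) (T∉Ts ∷ uTs) rewrite List.map-++ proj₁ (children T) (concat (map children Ts)) =
    Unique.++⁺ (children-distinct T) (concat-children-distinct Ts uTs) disjoint
    where
    disjoint : ∀ {H} → ¬ (H ∈ map proj₁ (children T) × H ∈ map proj₁ (concat (map children Ts)))
    disjoint (p , q) with T′ , T′∈ , q′ ← ∈-concat-children⁻ Ts q
                     with _ , _ , e ← ∈-children⁻ T p | _ , _ , e′ ← ∈-children⁻ T′ q′ =
      All.lookup T∉Ts (∈-map⁺ proj₁ T′∈) (extend-injectiveˡ (trans (sym e) e′))

  allStacked-distinct : ∀ d → Unique (map proj₁ (allStacked d))
  allStacked-distinct zero    = [] ∷ []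
  allStacked-distinct (suc d) = concat-children-distinct (allStacked d) (allStacked-distinct d)

  children-length : ∀ d (T : StackedTriangulation (4 + d)) → length (children T) ≡ d + (4 + d)
  children-length d (G , F , s) = trans (length-mapWith∈ (≡.setoid _) F) (ℕ.+-cancelˡ-≡ 4 _ _ (faces-length s))

  stackedCount : ℕ → ℕ
  stackedCount d = 2 ^ d * suc d !

  allStacked-length : ∀ d → length (allStacked d) ≡ stackedCount d
  allStacked-length zero    = refl
  allStacked-length (suc d) = begin
    length (concat (map children (allStacked d))) ≡⟨ length-concat-map children (allStacked d) (d + (4 + d))
        (λ {T} _ → children-length d T) ⟩
    length (allStacked d) * (d + (4 + d))         ≡⟨ cong (_* (d + (4 + d))) (allStacked-length d) ⟩
    (2 ^ d * suc d !) * (d + (4 + d))             ≡⟨ solve 3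
        (λ x f d → (x :* f) :* (d :+ (con 4 :+ d)) := (con 2 :* x) :* ((con 2 :+ d) :* f)) refl (2 ^ d) (suc d !) d ⟩
    stackedCount (suc d)                          ∎
    where
    open ≡.≡-Reasoning
    open import Data.Nat.Solver using (module +-*-Solver)
    open +-*-Solver

  stackedCount≤ : ∀ d (Ts : List (Graph (4 + d))) → EnumT (4 + d) Ts → stackedCount d ℕ.≤ length Ts
  stackedCount≤ d Ts (_ , Ts⇔𝒯) = subst (ℕ._≤ length Ts) (trans (List.length-map proj₁ (allStacked d)) (allStacked-length d))
    (unique-⊆⇒length≤ (allStacked-distinct d) all∈Ts)
    where
    all∈Ts : ∀ {G} → G ∈ map proj₁ (allStacked d) → G ∈ Ts
    all∈Ts G∈ with (H , F , s) , _ , refl ← ∈-map⁻ proj₁ G∈ = Equivalence.from (Ts⇔𝒯 H) (F , s)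

module InjectionCount where

  open import Data.Nat as ℕ using (ℕ; zero; suc; _*_; _!)
  import Data.Nat.Properties as ℕ
  open import Data.Fin using (Fin)
  open import Data.List using (List; []; _∷_; map; length; concat; allFin)
  import Data.List.Properties as List
  open import Data.List.Relation.Unary.Any using (here; there; _─_; index)
  import Data.List.Relation.Unary.All as All
  open import Data.List.Relation.Unary.AllPairs using (_∷_)
  open import Data.List.Membership.Propositional using (_∈_; mapWith∈)
  open import Data.List.Membership.Propositional.Properties using (∈-map⁺; ∈-concat⁺′; ∈-allFin)
  open import Data.List.Relation.Unary.Any.Properties using (mapWith∈⁺; mapWith∈⁻)
  open import Data.List.Relation.Unary.Unique.Propositional using (Unique)
  import Data.List.Relation.Unary.Unique.Propositional.Properties as Unique
  open import Data.List.Membership.Setoid.Properties using (length-mapWith∈)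
  open import Data.Product using (_,_; proj₁; proj₂)
  open import Relation.Binary.PropositionalEquality as ≡ using (_≡_; refl; sym; trans; cong; subst₂)
  open Stacking using (∈-─⁺)
  open ListCounting

  fallingFactorial : ℕ → ℕ → ℕ
  fallingFactorial k zero    = 1
  fallingFactorial k (suc m) = k * fallingFactorial (ℕ.pred k) m

  fallingFactorial-diagonal : ∀ n → fallingFactorial n n ≡ n !
  fallingFactorial-diagonal zero    = refl
  fallingFactorial-diagonal (suc n) = cong (suc n *_) (fallingFactorial-diagonal n)

  arrangements : ∀ {A : Set} → List A → ℕ → List (List A)
  arrangements U zero    = [] ∷ []
  arrangements U (suc m) = concat (mapWith∈ U λ {u} p → map (u ∷_) (arrangements (U ─ p) m))

  arrangements-length : ∀ {A : Set} (U : List A) m → length (arrangements U m) ≡ fallingFactorial (length U) m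
  arrangements-length U zero    = refl
  arrangements-length U (suc m) = length-concat-mapWith∈ U _ (fallingFactorial (ℕ.pred (length U)) m) λ {u} p →
    trans (List.length-map (u ∷_) (arrangements (U ─ p) m))
      (trans (arrangements-length (U ─ p) m) (cong (λ l → fallingFactorial (ℕ.pred l) m) (sym (List.length-removeAt′ U (index p)))))

  arrangements-complete : ∀ {A : Set} {U : List A} m (xs : List A) → Unique xs → length xs ≡ m →
    (∀ {x} → x ∈ xs → x ∈ U) → xs ∈ arrangements U m
  arrangements-complete zero    []       _          _      _     = here refl
  arrangements-complete {U = U} (suc m) (x ∷ xs) (x∉xs ∷ u) |xs|≡m xs⊆U =
    ∈-concat⁺′ (∈-map⁺ (x ∷_) (arrangements-complete m xs u (ℕ.suc-injective |xs|≡m)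
                  (λ q → ∈-─⁺ x∈U (xs⊆U (there q)) (λ e → All.lookup x∉xs q (sym e)))))
      (mapWith∈⁺ (λ {u} p → map (u ∷_) (arrangements (U ─ p) m)) (x , x∈U , refl))
    where
    x∈U = xs⊆U (here refl)

  map-≡⇒≡ : ∀ {A B : Set} {g h : A → B} (xs : List A) → map g xs ≡ map h xs → ∀ {x} → x ∈ xs → g x ≡ h x
  map-≡⇒≡ (y ∷ xs) e (here refl) = proj₁ (List.∷-injective e)
  map-≡⇒≡ (y ∷ xs) e (there p)   = map-≡⇒≡ xs (proj₂ (List.∷-injective e)) p

  -- Each item is recorded by the list of values of its injection: a repetition-free list of length n over Fin n.
  length≤n!-of-injection-labelled : ∀ {n} {B : Set} (Es : List B) → Unique Es →
    (σ : ∀ {G} → G ∈ Es → (Fin n → Fin n)) →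
    (∀ {G} (p : G ∈ Es) → ∀ {x y} → σ p x ≡ σ p y → x ≡ y) →
    (∀ {G H} (p : G ∈ Es) (q : H ∈ Es) → (∀ x → σ p x ≡ σ q x) → G ≡ H) →
    length Es ℕ.≤ n !
  length≤n!-of-injection-labelled {n} Es uEs σ σ-injective σ-determines =
    subst₂ ℕ._≤_ (length-mapWith∈ (≡.setoid _) Es) arrangements-of-Fin
      (unique-⊆⇒length≤ (mapWith∈-unique Es values uEs values-injective) values∈arrangements)
    where
    values : ∀ {G} → G ∈ Es → List (Fin n)
    values p = map (σ p) (allFin n)
    values-injective : ∀ {G H} (p : G ∈ Es) (q : H ∈ Es) → values p ≡ values q → G ≡ H
    values-injective p q e = σ-determines p q (λ x → map-≡⇒≡ (allFin n) e (∈-allFin x))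
    arrangements-of-Fin : length (arrangements (allFin n) n) ≡ n !
    arrangements-of-Fin = trans (arrangements-length (allFin n) n)
      (trans (cong (λ l → fallingFactorial l n) (List.length-tabulate (λ x → x))) (fallingFactorial-diagonal n))
    values∈arrangements : ∀ {vs} → vs ∈ mapWith∈ Es values → vs ∈ arrangements (allFin n) n
    values∈arrangements vs∈ with _ , p , refl ← mapWith∈⁻ Es values vs∈ =
      arrangements-complete n (values p) (Unique.map⁺ (σ-injective p) (Unique.allFin⁺ n))
        (trans (List.length-map (σ p) (allFin n)) (List.length-tabulate (λ x → x))) (λ {x} _ → ∈-allFin x)
module EmbeddingUniqueness {c ℓ ℓ<} (𝔽 : OrderedField c ℓ ℓ<) where

  open import Data.Nat using (ℕ; suc; s≤s)
  open import Data.Fin as Fin using (Fin; inject₁; fromℕ; _≟_)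
  import Data.Fin.Properties as Fin
  open import Data.Fin.Patterns using (0F; 1F; 2F; 3F)
  open import Data.List using (List; _++_; map)
  open import Data.List.Relation.Unary.Any using (here; there; _─_)
  open import Data.List.Membership.Propositional using (_∈_)
  open import Data.List.Membership.Propositional.Properties using (∈-map⁺; ∈-++⁺ˡ; ∈-++⁺ʳ)
  open import Data.Product using (Σ; ∃; _×_; _,_; proj₁; proj₂)
  open import Data.Sum as Sum using (_⊎_; inj₁; inj₂)
  open import Data.Empty using (⊥; ⊥-elim)
  open import Relation.Nullary using (¬_; yes; no)
  open import Relation.Binary.PropositionalEquality using (_≡_; _≢_; refl; sym; trans; cong; subst)
  open PlaneGeometry 𝔽 hiding (refl; sym; trans)
  open Stacking

  InFace : ∀ {m} → (Fin m → Point) → Triangle m → Point → Set ℓ<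
  InFace P f q = InTriangle (P (proj₁ f)) (P (proj₁ (proj₂ f))) (P (proj₂ (proj₂ f))) q

  OnOppositeSides : ∀ {m} → (Fin m → Point) → Triangle m → Point → Point → Set ℓ<
  OnOppositeSides P f A B = (InFace P f A × ¬ InFace P f B) ⊎ (¬ InFace P f A × InFace P f B)

  -- f separates q when q and the vertices off f lie on opposite sides of f's triangle
  -- (the second alternative is the case of the outer face).
  Separates : ∀ {m} → (Fin m → Point) → Triangle m → Point → Set ℓ<
  Separates P f q = (InFace P f q × (∀ v → NotCorner f v → ¬ InFace P f (P v))) ⊎
      (¬ InFace P f q × (∀ v → NotCorner f v → InFace P f (P v)))

  separates-vertex : ∀ {m} {P : Fin m → Point} {f q} → Separates P f q → ∀ v → NotCorner f v → OnOppositeSides P f q (P v)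
  separates-vertex (inj₁ (a , b)) v nv = inj₁ (a , b v nv)
  separates-vertex (inj₂ (a , b)) v nv = inj₂ (a , b v nv)

  OffDrawing : ∀ {m} → Graph m → (Fin m → Point) → Point → Set _
  OffDrawing H P q = ∀ a b → Adj H a b → ¬ OnSeg (P a) (P b) q

  FacesSeparate : ∀ {m} → Graph m → List (Triangle m) → (Fin m → Point) → Set _
  FacesSeparate {m} H F P = ∀ q → OffDrawing H P q → Σ (Triangle m) (λ f → (f ∈ F) × Separates P f q)

  module Drawing {m : ℕ} {H : Graph m} {P : Fin m → Point} (le : LabelledEmbedding H P) where

    private
      distinct : Distinct P
      distinct = proj₁ le
      vertex-on-edge : ∀ a b v → Adj H a b → OnSeg (P a) (P b) (P v) → (v ≡ a) ⊎ (v ≡ b)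
      vertex-on-edge = proj₁ (proj₂ le)

    Adjacent : Fin m → Fin m → Set
    Adjacent u v = Adj H u v ⊎ Adj H v u

    adjacent-vertex-on-edge : ∀ {u v z} → Adjacent u v → OnSeg (P u) (P v) (P z) → (z ≡ u) ⊎ (z ≡ v)
    adjacent-vertex-on-edge {u} {v} {z} (inj₁ e) s = vertex-on-edge u v z e s
    adjacent-vertex-on-edge {u} {v} {z} (inj₂ e) s = Sum.swap (vertex-on-edge v u z e (onSeg-sym (P u) (P v) (P z) s))

    disjoint-edges : ∀ {u l x y} → Adj H u l → Adj H x y → u ≢ x → u ≢ y → l ≢ x → l ≢ y →
             ∀ r → OnSeg (P u) (P l) r → OnSeg (P x) (P y) r → ⊥
    disjoint-edges {u} {l} {x} {y} e1 e2 ux uy lx ly r s1 s2 with proj₂ (proj₂ le) u l x y e1 e2 (λ z → ux (proj₁ z))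
        (λ z → uy (proj₁ z)) r s1 s2
    ... | v , inj₁ refl , inj₁ refl , _ = ux refl
    ... | v , inj₁ refl , inj₂ refl , _ = uy refl
    ... | v , inj₂ refl , inj₁ refl , _ = lx refl
    ... | v , inj₂ refl , inj₂ refl , _ = ly refl

    disjoint-adjacent : ∀ {u l x y} → Adjacent u l → Adjacent x y → u ≢ x → u ≢ y → l ≢ x → l ≢ y →
             ∀ r → OnSeg (P u) (P l) r → OnSeg (P x) (P y) r → ⊥
    disjoint-adjacent {u} {l} {x} {y} (inj₁ e1) (inj₁ e2) ux uy lx ly r s1 s2 = disjoint-edges e1 e2 ux uy lx ly r s1 s2
    disjoint-adjacent {u} {l} {x} {y} (inj₂ e1) (inj₁ e2) ux uy lx ly r s1 s2 =
      disjoint-edges e1 e2 lx ly ux uy r (onSeg-sym (P u) (P l) r s1) s2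
    disjoint-adjacent {u} {l} {x} {y} (inj₁ e1) (inj₂ e2) ux uy lx ly r s1 s2 =
      disjoint-edges e1 e2 uy ux ly lx r s1 (onSeg-sym (P x) (P y) r s2)
    disjoint-adjacent {u} {l} {x} {y} (inj₂ e1) (inj₂ e2) ux uy lx ly r s1 s2 =
      disjoint-edges e1 e2 ly lx uy ux r (onSeg-sym (P u) (P l) r s1) (onSeg-sym (P x) (P y) r s2)

    adjacent-noncollinear : ∀ {x y z} → x ≢ y → x ≢ z → y ≢ z → Adjacent x y → Adjacent x z → Adjacent z y →
      ¬ (det (P x) (P y) (P z) ≈ 0#)
    adjacent-noncollinear {x} {y} {z} xy xz yz exy exz ezy d0 with collinear-onSeg (P x) (P y) (P z)
        (λ e → xy (distinct x y e)) d0
    ... | inj₁ s with adjacent-vertex-on-edge exy s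
    ...   | inj₁ e = xz (sym e)
    ...   | inj₂ e = yz (sym e)
    adjacent-noncollinear {x} {y} {z} xy xz yz exy exz ezy d0 | inj₂ (inj₁ s) with adjacent-vertex-on-edge exz s
    ...   | inj₁ e = xy (sym e)
    ...   | inj₂ e = yz e
    adjacent-noncollinear {x} {y} {z} xy xz yz exy exz ezy d0 | inj₂ (inj₂ s) with adjacent-vertex-on-edge ezy s
    ...   | inj₁ e = xz e
    ...   | inj₂ e = xy e

    K4-drawing : ∀ {x0 x1 x2 x3} →
      x0 ≢ x1 → x0 ≢ x2 → x0 ≢ x3 → x1 ≢ x2 → x1 ≢ x3 → x2 ≢ x3 →
      Adjacent x0 x1 → Adjacent x0 x2 → Adjacent x0 x3 → Adjacent x1 x2 → Adjacent x1 x3 → Adjacent x2 x3 →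
      OneInsideTheOthers (P x0) (P x1) (P x2) (P x3)
    K4-drawing d01 d02 d03 d12 d13 d23 e01 e02 e03 e12 e13 e23 =
      one-inside-the-others _ _ _ _
        (adjacent-noncollinear d01 d02 d12 e01 e02 (symU e12))
        (adjacent-noncollinear d01 d03 d13 e01 e03 (symU e13))
        (adjacent-noncollinear d12 d13 d23 e12 e13 (symU e23))
        (adjacent-noncollinear (λ e → d02 (sym e)) d23 d03 (symU e02) e23 (symU e03))
        (λ (X , s1 , s2) → disjoint-adjacent e01 e23 d02 d03 d12 d13 X s1 s2)
        (λ (X , s1 , s2) → disjoint-adjacent e12 e03 (λ e → d01 (sym e)) d13 (λ e → d02 (sym e)) d23 X s1 s2)
        (λ (X , s1 , s2) → disjoint-adjacent (symU e02) e13 (λ e → d12 (sym e)) d23 d01 d03 X s1 s2)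
      where
      symU : ∀ {u v} → Adjacent u v → Adjacent v u
      symU = Sum.swap

    no-edge-across-face : ∀ f → FaceEdges H f → ∀ u l → NotCorner f u → NotCorner f l → Adjacent u l →
      OnOppositeSides P f (P u) (P l) → ⊥
    no-edge-across-face (f₁ , f₂ , f₃) (e₁₂ , e₂₃ , e₁₃) u l (u₁ , u₂ , u₃) (l₁ , l₂ , l₃) ul sides
      with segment-meets-boundary sides
    ... | r , r∈ul , inj₁ r∈₁₂        = disjoint-adjacent ul (inj₁ e₁₂) u₁ u₂ l₁ l₂ r r∈ul r∈₁₂
    ... | r , r∈ul , inj₂ (inj₁ r∈₂₃) = disjoint-adjacent ul (inj₁ e₂₃) u₂ u₃ l₂ l₃ r r∈ul r∈₂₃
    ... | r , r∈ul , inj₂ (inj₂ r∈₁₃) = disjoint-adjacent ul (inj₁ e₁₃) u₁ u₃ l₁ l₃ r r∈ul r∈₁₃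


  restrict : ∀ {n} {G : Graph n} {i j k} {P⁺ : Fin (suc n) → Point} →
    LabelledEmbedding (extend G i j k) P⁺ → LabelledEmbedding G (λ a → P⁺ (inject₁ a))
  restrict {n} {G} {i} {j} {k} {P⁺} (distinct , vertex-on-edge , edges-meet) = distinct′ , vertex-on-edge′ , edges-meet′
    where
    open Extend G i j k
    P : Fin n → Point
    P a = P⁺ (inject₁ a)
    distinct′ : ∀ a b → P a ≈ₚ P b → a ≡ b
    distinct′ a b e = Fin.inject₁-injective (distinct (inject₁ a) (inject₁ b) e)
    vertex-on-edge′ : ∀ a b v → Adj G a b → OnSeg (P a) (P b) (P v) → (v ≡ a) ⊎ (v ≡ b)
    vertex-on-edge′ a b v e s = Sum.map Fin.inject₁-injective Fin.inject₁-injective (vertex-on-edge _ _ _ (adj-old⁺ e) s)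
    edges-meet′ : ∀ a b a' b' → Adj G a b → Adj G a' b' →
       ¬ ((a ≡ a') × (b ≡ b')) → ¬ ((a ≡ b') × (b ≡ a')) →
       ∀ q → OnSeg (P a) (P b) q → OnSeg (P a') (P b') q →
       ∃ λ v → ((v ≡ a) ⊎ (v ≡ b)) × ((v ≡ a') ⊎ (v ≡ b')) × (q ≈ₚ P v)
    edges-meet′ a b a' b' e e' n1 n2 q s s' with edges-meet (inject₁ a) (inject₁ b) (inject₁ a') (inject₁ b') (adj-old⁺ e) (adj-old⁺ e')
          (λ z → n1 (Fin.inject₁-injective (proj₁ z) , Fin.inject₁-injective (proj₂ z)))
              (λ z → n2 (Fin.inject₁-injective (proj₁ z) , Fin.inject₁-injective (proj₂ z))) q s s'
    ... | v , inj₁ refl , p2 , qv = a , inj₁ refl , Sum.map Fin.inject₁-injective Fin.inject₁-injective p2 , qv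
    ... | v , inj₂ refl , p2 , qv = b , inj₂ refl , Sum.map Fin.inject₁-injective Fin.inject₁-injective p2 , qv

  module Extension {n} {G : Graph n} {F : List (Triangle n)} (wf : WellFormed n G F) (i j k : Fin n)
      (i<j<k : Sorted (i , j , k)) {P⁺ : Fin (suc n) → Point} (le⁺ : LabelledEmbedding (extend G i j k) P⁺) where
    open Extend G i j k
    open Drawing {H = G⁺} {P = P⁺} le⁺
    P : Fin n → Point
    P a = P⁺ (inject₁ a)
    Pnew : Point
    Pnew = P⁺ new
    f : Triangle n
    f = (i , j , k)

    offDrawing-restrict : ∀ {q} → OffDrawing G⁺ P⁺ q → OffDrawing G P q
    offDrawing-restrict off a b e = off (inject₁ a) (inject₁ b) (adj-old⁺ e)

    new-offDrawing : OffDrawing G P Pnew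
    new-offDrawing a b e s with proj₁ (proj₂ le⁺) (inject₁ a) (inject₁ b) new (adj-old⁺ e) s
    ... | inj₁ x = Fin.fromℕ≢inject₁ x
    ... | inj₂ x = Fin.fromℕ≢inject₁ x

    notCorner-lift : ∀ {g : Triangle n} {v} → NotCorner g v → NotCorner (liftT g) (inject₁ v)
    notCorner-lift (a , b , c) = (λ e → a (Fin.inject₁-injective e)) , (λ e → b (Fin.inject₁-injective e)) ,
        (λ e → c (Fin.inject₁-injective e))

    notCorner-unlift : ∀ {g : Triangle n} {v} → NotCorner (liftT g) (inject₁ v) → NotCorner g v
    notCorner-unlift (a , b , c) = (λ e → a (cong inject₁ e)) , (λ e → b (cong inject₁ e)) , (λ e → c (cong inject₁ e))

    new-notCorner : ∀ (g : Triangle n) → NotCorner (liftT g) new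
    new-notCorner g = Fin.fromℕ≢inject₁ , Fin.fromℕ≢inject₁ , Fin.fromℕ≢inject₁

    faceEdges-lift : ∀ {g} → g ∈ F → FaceEdges G⁺ (liftT g)
    faceEdges-lift {g1 , g2 , g3} gm with WellFormed.edges wf gm
    ... | a , b , c = adj-old⁺ a , adj-old⁺ b , adj-old⁺ c

    -- Otherwise the new vertex is adjacent to a corner l of f off g, and the edge to l would cross g's boundary.
    separating-face-attached : ∀ g → g ∈ F → Separates P g Pnew → g ≡ f
    separating-face-attached g gm sp with triangle-≟ g f
    ... | yes e = e
    ... | no ne with corner-outside g (WellFormed.sorted wf gm) i<j<k ne
    ...   | l , ml , nl = ⊥-elim
        (no-edge-across-face (liftT g) (faceEdges-lift gm) new (inject₁ l) (new-notCorner g) (notCorner-lift nl)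
                              (inj₁ (adj-new-old⁺ ml)) (separates-vertex {P = P} sp l nl))

    offDrawing-adjacent : ∀ {q u v} → OffDrawing G⁺ P⁺ q → Adjacent u v → ¬ OnSeg (P⁺ u) (P⁺ v) q
    offDrawing-adjacent {q} {u} {v} off (inj₁ e) s = off u v e s
    offDrawing-adjacent {q} {u} {v} off (inj₂ e) s = off v u e (onSeg-sym (P⁺ u) (P⁺ v) q s)

    module Step (inv : FacesSeparate G F P) (m : f ∈ F) where
      F⁺ : List (Triangle (suc n))
      F⁺ = map liftT (F ─ m) ++ newFaces i j k
      eij : Adj G i j
      eij = proj₁ (WellFormed.edges wf m)
      ejk : Adj G j k
      ejk = proj₁ (proj₂ (WellFormed.edges wf m))
      eik : Adj G i k
      eik = proj₂ (proj₂ (WellFormed.edges wf m))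

      attached-separates : Separates P f Pnew
      attached-separates with inv Pnew new-offDrawing
      ... | g , gm , sp with separating-face-attached g gm sp
      ...   | refl = sp

      ¬other-separates : ∀ g → g ∈ F → g ≢ f → ¬ Separates P g Pnew
      ¬other-separates g gm ne sp = ne (separating-face-attached g gm sp)

      face-ij face-jk face-ik : Triangle (suc n)
      face-ij = (inject₁ i , inject₁ j , new)
      face-jk = (inject₁ j , inject₁ k , new)
      face-ik = (inject₁ i , inject₁ k , new)
      face-ij∈ : face-ij ∈ F⁺
      face-ij∈ = ∈-++⁺ʳ (map liftT (F ─ m)) (here refl)
      face-jk∈ : face-jk ∈ F⁺
      face-jk∈ = ∈-++⁺ʳ (map liftT (F ─ m)) (there (here refl))
      face-ik∈ : face-ik ∈ F⁺
      face-ik∈ = ∈-++⁺ʳ (map liftT (F ─ m)) (there (there (here refl)))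

      separates-lift : ∀ {q} g → g ∈ F → g ≢ f → Separates P g q → Separates P⁺ (liftT g) q
      separates-lift {q} g gm ne (inj₁ (iq , outs)) = inj₁ (iq , go)
        where
        go : ∀ v → NotCorner (liftT g) v → ¬ InFace P⁺ (liftT g) (P⁺ v)
        go v nv with inject₁-or-fromℕ v
        ... | inj₁ (v0 , refl) = outs v0 (notCorner-unlift nv)
        ... | inj₂ refl = λ iw → ¬other-separates g gm ne (inj₁ (iw , outs))
      separates-lift {q} g gm ne (inj₂ (nq , ins)) = inj₂ (nq , go)
        where
        go : ∀ v → NotCorner (liftT g) v → InFace P⁺ (liftT g) (P⁺ v)
        go v nv with inject₁-or-fromℕ v
        ... | inj₁ (v0 , refl) = ins v0 (notCorner-unlift nv)
        ... | inj₂ refl with inTriangle? (P (proj₁ g)) (P (proj₁ (proj₂ g))) (P (proj₂ (proj₂ g))) Pnew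
        ...   | yes iw = iw
        ...   | no nw = ⊥-elim (¬other-separates g gm ne (inj₂ (nw , ins)))

      Cover : Fin n → Fin n → Fin n → Set
      Cover s t r = ∀ v0 → v0 ≢ s → v0 ≢ t → v0 ≢ r → NotCorner f v0

      separates-inside : ∀ {q s t r} → Cover s t r →
        InFace P⁺ (inject₁ s , inject₁ t , new) q → ¬ InFace P⁺ (inject₁ s , inject₁ t , new) (P r) →
        (∀ v0 → NotCorner f v0 → ¬ InFace P⁺ (inject₁ s , inject₁ t , new) (P v0)) →
        Separates P⁺ (inject₁ s , inject₁ t , new) q
      separates-inside {q} {s} {t} {r} cov iq nr outs = inj₁ (iq , go)
        where
        go : ∀ v → NotCorner (inject₁ s , inject₁ t , new) v → ¬ InFace P⁺ (inject₁ s , inject₁ t , new) (P⁺ v)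
        go v (n1 , n2 , n3) with inject₁-or-fromℕ v
        ... | inj₂ refl = ⊥-elim (n3 refl)
        ... | inj₁ (v0 , refl) with v0 ≟ r
        ...   | yes refl = nr
        ...   | no nr' = outs v0 (cov v0 (λ e → n1 (cong inject₁ e)) (λ e → n2 (cong inject₁ e)) nr')

      separates-outside : ∀ {q s t r} → Cover s t r →
        ¬ InFace P⁺ (inject₁ s , inject₁ t , new) q → InFace P⁺ (inject₁ s , inject₁ t , new) (P r) →
        (∀ v0 → NotCorner f v0 → InFace P⁺ (inject₁ s , inject₁ t , new) (P v0)) →
        Separates P⁺ (inject₁ s , inject₁ t , new) q
      separates-outside {q} {s} {t} {r} cov nq ir ins = inj₂ (nq , go)
        where
        go : ∀ v → NotCorner (inject₁ s , inject₁ t , new) v → InFace P⁺ (inject₁ s , inject₁ t , new) (P⁺ v)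
        go v (n1 , n2 , n3) with inject₁-or-fromℕ v
        ... | inj₂ refl = ⊥-elim (n3 refl)
        ... | inj₁ (v0 , refl) with v0 ≟ r
        ...   | yes refl = ir
        ...   | no nr' = ins v0 (cov v0 (λ e → n1 (cong inject₁ e)) (λ e → n2 (cong inject₁ e)) nr')

      cover-ij : Cover i j k
      cover-ij v0 a b c = a , b , c
      cover-jk : Cover j k i
      cover-jk v0 a b c = c , a , b
      cover-ik : Cover i k j
      cover-ik v0 a b c = a , c , b

      SeparatedBy⁺ : Point → Set ℓ<
      SeparatedBy⁺ q = Σ (Triangle (suc n)) (λ h → (h ∈ F⁺) × Separates P⁺ h q)

      i∈ : OneOf₃ i j k i
      i∈ = inj₁ refl
      j∈ : OneOf₃ i j k j
      j∈ = inj₂ (inj₁ refl)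
      k∈ : OneOf₃ i j k k
      k∈ = inj₂ (inj₂ refl)

      -- q and the new vertex lie inside f: the new vertex splits f into three triangles, one of which contains q.
      inner-case : ∀ q → OffDrawing G⁺ P⁺ q → InTriangle (P i) (P j) (P k) q → InTriangle (P i) (P j) (P k) Pnew →
        (∀ v0 → NotCorner f v0 → ¬ InTriangle (P i) (P j) (P k) (P v0)) → SeparatedBy⁺ q
      inner-case q off iq iw outs with inTriangle-subdivide iq iw (offDrawing-adjacent off (inj₁ (adj-new-old⁺ i∈)))
          (offDrawing-adjacent off (inj₁ (adj-new-old⁺ j∈))) (offDrawing-adjacent off (inj₁ (adj-new-old⁺ k∈)))
      ... | inj₁ t = face-ij , face-ij∈ , separates-inside cover-ij t (¬inTriangle-exchange iw)
          (λ v0 nv ib → outs v0 nv (inTriangle-trans iw ib))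
      ... | inj₂ (inj₁ t) = face-jk , face-jk∈ , separates-inside cover-jk t (¬inTriangle-exchange (inTriangle-rotate iw))
          (λ v0 nv ib → outs v0 nv (inTriangle-rotate (inTriangle-rotate (inTriangle-trans (inTriangle-rotate iw) ib))))
      ... | inj₂ (inj₂ t) = face-ik , face-ik∈ , separates-inside cover-ik (inTriangle-swap₁₂ t)
          (¬inTriangle-exchange (inTriangle-swap₂₃ iw))
          (λ v0 nv ib → outs v0 nv (inTriangle-swap₂₃ (inTriangle-trans (inTriangle-swap₂₃ iw) ib)))

      outer-split : ∀ {x y z W q} → InTriangle x y W z → ¬ InTriangle x y z q → ¬ OnSeg z x q → ¬ OnSeg z y q → ¬ OnSeg z W q →
        (¬ InTriangle x y W q) ⊎ (InTriangle y z W q ⊎ InTriangle x z W q)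
      outer-split {x} {y} {z} {W} {q} cz nq sx sy sW with inTriangle? x y W q
      ... | no nt = inj₁ nt
      ... | yes iq with inTriangle-subdivide iq cz sx sy sW
      ...   | inj₁ t = ⊥-elim (nq t)
      ...   | inj₂ (inj₁ t) = inj₂ (inj₁ (inTriangle-swap₂₃ t))
      ...   | inj₂ (inj₂ t) = inj₂ (inj₂ (inTriangle-rotate t))

      Aij : Adjacent (inject₁ i) (inject₁ j)
      Aij = inj₁ (adj-old⁺ eij)
      Aji : Adjacent (inject₁ j) (inject₁ i)
      Aji = inj₂ (adj-old⁺ eij)
      Aik : Adjacent (inject₁ i) (inject₁ k)
      Aik = inj₁ (adj-old⁺ eik)
      Aki : Adjacent (inject₁ k) (inject₁ i)
      Aki = inj₂ (adj-old⁺ eik)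
      Ajk : Adjacent (inject₁ j) (inject₁ k)
      Ajk = inj₁ (adj-old⁺ ejk)
      Akj : Adjacent (inject₁ k) (inject₁ j)
      Akj = inj₂ (adj-old⁺ ejk)
      Aiw : Adjacent (inject₁ i) new
      Aiw = inj₁ (adj-old-new⁺ i∈)
      Ajw : Adjacent (inject₁ j) new
      Ajw = inj₁ (adj-old-new⁺ j∈)
      Akw : Adjacent (inject₁ k) new
      Akw = inj₁ (adj-old-new⁺ k∈)

      -- f is the outer face: by planarity one of the corners, say P i, lies inside the triangle P j P k Pnew,
      -- and q lies outside that triangle or inside P i P j Pnew or P i P k Pnew.
      outer-case : ∀ q → OffDrawing G⁺ P⁺ q → ¬ InTriangle (P i) (P j) (P k) q → ¬ InTriangle (P i) (P j) (P k) Pnew →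
        (∀ v0 → NotCorner f v0 → InTriangle (P i) (P j) (P k) (P v0)) → SeparatedBy⁺ q
      outer-case q off nq nw ins with K4-drawing {inject₁ i} {inject₁ j} {inject₁ k} {new}
            (λ e → Fin.<⇒≢ (proj₁ i<j<k) (Fin.inject₁-injective e))
                (λ e → Fin.<⇒≢ (Fin.<-trans (proj₁ i<j<k) (proj₂ i<j<k)) (Fin.inject₁-injective e)) inject₁≢fromℕ
            (λ e → Fin.<⇒≢ (proj₂ i<j<k) (Fin.inject₁-injective e)) inject₁≢fromℕ inject₁≢fromℕ
            Aij Aik Aiw Ajk Ajw Akw
      ... | inj₂ (inj₂ (inj₂ t)) = ⊥-elim (nw t)
      ... | inj₁ cz with outer-split cz (λ t → nq (inTriangle-rotate (inTriangle-rotate t))) (offDrawing-adjacent off Aij)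
          (offDrawing-adjacent off Aik) (offDrawing-adjacent off Aiw)
      ...   | inj₁ nt = face-jk , face-jk∈ , separates-outside cover-jk nt cz
          (λ v0 nv → inTriangle-trans cz (inTriangle-rotate (ins v0 nv)))
      ...   | inj₂ (inj₁ t) = face-ik , face-ik∈ , separates-inside cover-ik (inTriangle-swap₁₂ t)
          (λ s → ¬inTriangle-exchange (inTriangle-rotate cz) (inTriangle-swap₂₃ (inTriangle-swap₁₂ s)))
                                  (λ v0 nv s → ¬inTriangle-opposite cz (inTriangle-rotate (ins v0 nv)) (inTriangle-swap₁₂ s))
      ...   | inj₂ (inj₂ t) = face-ij , face-ij∈ , separates-inside cover-ij (inTriangle-swap₁₂ t)
          (λ s → ¬inTriangle-exchange (inTriangle-swap₂₃ cz) (inTriangle-swap₂₃ (inTriangle-swap₁₂ s)))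
                                  (λ v0 nv s → ¬inTriangle-opposite (inTriangle-swap₁₂ cz) (inTriangle-swap₁₂ (inTriangle-rotate (ins v0 nv))) (inTriangle-swap₁₂ s))
      outer-case q off nq nw ins | inj₂ (inj₁ cz) with outer-split cz (λ t → nq (inTriangle-swap₂₃ t))
          (offDrawing-adjacent off Aji) (offDrawing-adjacent off Ajk) (offDrawing-adjacent off Ajw)
      ...   | inj₁ nt = face-ik , face-ik∈ , separates-outside cover-ik nt cz
          (λ v0 nv → inTriangle-trans cz (inTriangle-swap₂₃ (ins v0 nv)))
      ...   | inj₂ (inj₁ t) = face-jk , face-jk∈ , separates-inside cover-jk (inTriangle-swap₁₂ t)
          (λ s → ¬inTriangle-exchange (inTriangle-rotate cz) (inTriangle-swap₂₃ (inTriangle-swap₁₂ s)))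
                                  (λ v0 nv s → ¬inTriangle-opposite cz (inTriangle-swap₂₃ (ins v0 nv)) (inTriangle-swap₁₂ s))
      ...   | inj₂ (inj₂ t) = face-ij , face-ij∈ , separates-inside cover-ij t
          (λ s → ¬inTriangle-exchange (inTriangle-swap₂₃ cz) (inTriangle-swap₂₃ s))
                                  (λ v0 nv s → ¬inTriangle-opposite (inTriangle-swap₁₂ cz) (inTriangle-swap₁₂ (inTriangle-swap₂₃ (ins v0 nv))) s)
      outer-case q off nq nw ins | inj₂ (inj₂ (inj₁ cz)) with outer-split cz nq (offDrawing-adjacent off Aki)
          (offDrawing-adjacent off Akj) (offDrawing-adjacent off Akw)
      ...   | inj₁ nt = face-ij , face-ij∈ , separates-outside cover-ij nt cz (λ v0 nv → inTriangle-trans cz (ins v0 nv))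
      ...   | inj₂ (inj₁ t) = face-jk , face-jk∈ , separates-inside cover-jk t
          (λ s → ¬inTriangle-exchange (inTriangle-rotate cz) (inTriangle-swap₂₃ s))
                                  (λ v0 nv s → ¬inTriangle-opposite cz (ins v0 nv) s)
      ...   | inj₂ (inj₂ t) = face-ik , face-ik∈ , separates-inside cover-ik t
          (λ s → ¬inTriangle-exchange (inTriangle-swap₂₃ cz) (inTriangle-swap₂₃ s))
                                  (λ v0 nv s → ¬inTriangle-opposite (inTriangle-swap₁₂ cz) (inTriangle-swap₁₂ (ins v0 nv)) s)

      facesSeparate-step : FacesSeparate G⁺ F⁺ P⁺
      facesSeparate-step q off with inv q (offDrawing-restrict off)
      ... | g , gm , sp with triangle-≟ g f
      ...   | no ne = liftT g , ∈-++⁺ˡ (∈-map⁺ liftT (∈-─⁺ m gm ne)) , separates-lift g gm ne sp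
      ...   | yes refl with missing-corner (WellFormed.4≤n wf) f
      ...     | v4 , nv4 with sp | attached-separates
      ...       | inj₁ (iq , outs) | inj₁ (iw , _) = inner-case q off iq iw outs
      ...       | inj₁ (iq , outs) | inj₂ (_ , ins) = ⊥-elim (outs v4 nv4 (ins v4 nv4))
      ...       | inj₂ (_ , ins) | inj₁ (_ , outs) = ⊥-elim (outs v4 nv4 (ins v4 nv4))
      ...       | inj₂ (nq , ins) | inj₂ (nw , _) = outer-case q off nq nw ins

  module BaseCase {P : Fin 4 → Point} (le : LabelledEmbedding K4 P) where
    open Drawing {H = K4} {P = P} le
    only-3F : ∀ (v : Fin 4) → NotCorner {4} (0F , 1F , 2F) v → v ≡ 3F
    only-3F 0F (a , _) = ⊥-elim (a refl)
    only-3F 1F (_ , b , _) = ⊥-elim (b refl)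
    only-3F 2F (_ , _ , c) = ⊥-elim (c refl)
    only-3F 3F _ = refl
    only-2F : ∀ (v : Fin 4) → NotCorner {4} (0F , 1F , 3F) v → v ≡ 2F
    only-2F 0F (a , _) = ⊥-elim (a refl)
    only-2F 1F (_ , b , _) = ⊥-elim (b refl)
    only-2F 2F _ = refl
    only-2F 3F (_ , _ , c) = ⊥-elim (c refl)
    only-1F : ∀ (v : Fin 4) → NotCorner {4} (0F , 2F , 3F) v → v ≡ 1F
    only-1F 0F (a , _) = ⊥-elim (a refl)
    only-1F 1F _ = refl
    only-1F 2F (_ , b , _) = ⊥-elim (b refl)
    only-1F 3F (_ , _ , c) = ⊥-elim (c refl)
    only-0F : ∀ (v : Fin 4) → NotCorner {4} (1F , 2F , 3F) v → v ≡ 0F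
    only-0F 0F _ = refl
    only-0F 1F (a , _) = ⊥-elim (a refl)
    only-0F 2F (_ , b , _) = ⊥-elim (b refl)
    only-0F 3F (_ , _ , c) = ⊥-elim (c refl)

    separates-in : ∀ {f : Triangle 4} {q r} → (∀ v → NotCorner f v → v ≡ r) → InFace P f q → ¬ InFace P f
        (P r) → Separates P f q
    separates-in {f} rem iq nr = inj₁ (iq , λ v nv → subst (λ u → ¬ InFace P f (P u)) (sym (rem v nv)) nr)

    separates-out : ∀ {f : Triangle 4} {q r} → (∀ v → NotCorner f v → v ≡ r) → ¬ InFace P f q → InFace P f
        (P r) → Separates P f q
    separates-out {f} rem nq ir = inj₂ (nq , λ v nv → subst (λ u → InFace P f (P u)) (sym (rem v nv)) ir)

    face-012 : (0F , 1F , 2F) ∈ K4faces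
    face-012 = here refl
    face-013 : (0F , 1F , 3F) ∈ K4faces
    face-013 = there (here refl)
    face-023 : (0F , 2F , 3F) ∈ K4faces
    face-023 = there (there (here refl))
    face-123 : (1F , 2F , 3F) ∈ K4faces
    face-123 = there (there (there (here refl)))

    facesSeparate-K4 : FacesSeparate K4 K4faces P
    facesSeparate-K4 q off with K4-drawing {0F} {1F} {2F} {3F} (λ ()) (λ ()) (λ ()) (λ ()) (λ ()) (λ ())
                         (inj₁ refl) (inj₁ refl) (inj₁ refl) (inj₁ refl) (inj₁ refl) (inj₁ refl)
    ... | inj₂ (inj₂ (inj₂ cz)) with inTriangle? (P 0F) (P 1F) (P 2F) q
    ...   | no nt = _ , face-012 , separates-out only-3F nt cz
    ...   | yes iq with inTriangle-subdivide iq cz (off 3F 0F refl) (off 3F 1F refl) (off 3F 2F refl)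
    ...     | inj₁ t = _ , face-013 , separates-in only-2F t (¬inTriangle-exchange cz)
    ...     | inj₂ (inj₁ t) = _ , face-123 , separates-in only-0F t (¬inTriangle-exchange (inTriangle-rotate cz))
    ...     | inj₂ (inj₂ t) = _ , face-023 , separates-in only-1F (inTriangle-swap₁₂ t)
        (¬inTriangle-exchange (inTriangle-swap₂₃ cz))
    facesSeparate-K4 q off | inj₂ (inj₂ (inj₁ cz)) with inTriangle? (P 0F) (P 1F) (P 3F) q
    ...   | no nt = _ , face-013 , separates-out only-2F nt cz
    ...   | yes iq with inTriangle-subdivide iq cz (off 2F 0F refl) (off 2F 1F refl) (off 2F 3F refl)
    ...     | inj₁ t = _ , face-012 , separates-in only-3F t (¬inTriangle-exchange cz)
    ...     | inj₂ (inj₁ t) = _ , face-123 , separates-in only-0F (inTriangle-swap₂₃ t)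
        (λ s → ¬inTriangle-exchange (inTriangle-rotate cz) (inTriangle-swap₂₃ s))
    ...     | inj₂ (inj₂ t) = _ , face-023 , separates-in only-1F (inTriangle-rotate t)
        (λ s → ¬inTriangle-exchange (inTriangle-swap₂₃ cz) (inTriangle-swap₂₃ s))
    facesSeparate-K4 q off | inj₂ (inj₁ cz) with inTriangle? (P 0F) (P 2F) (P 3F) q
    ...   | no nt = _ , face-023 , separates-out only-1F nt cz
    ...   | yes iq with inTriangle-subdivide iq cz (off 1F 0F refl) (off 1F 2F refl) (off 1F 3F refl)
    ...     | inj₁ t = _ , face-012 , separates-in only-3F (inTriangle-swap₂₃ t)
        (λ s → ¬inTriangle-exchange cz (inTriangle-swap₂₃ s))
    ...     | inj₂ (inj₁ t) = _ , face-123 , separates-in only-0F (inTriangle-rotate (inTriangle-rotate t))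
        (λ s → ¬inTriangle-exchange (inTriangle-rotate cz) (inTriangle-rotate s))
    ...     | inj₂ (inj₂ t) = _ , face-013 , separates-in only-2F (inTriangle-rotate t)
        (λ s → ¬inTriangle-exchange (inTriangle-swap₂₃ cz) (inTriangle-swap₂₃ s))
    facesSeparate-K4 q off | inj₁ cz with inTriangle? (P 1F) (P 2F) (P 3F) q
    ...   | no nt = _ , face-123 , separates-out only-0F nt cz
    ...   | yes iq with inTriangle-subdivide iq cz (off 0F 1F refl) (off 0F 2F refl) (off 0F 3F refl)
    ...     | inj₁ t = _ , face-012 , separates-in only-3F (inTriangle-rotate (inTriangle-rotate t))
        (λ s → ¬inTriangle-exchange cz (inTriangle-rotate s))
    ...     | inj₂ (inj₁ t) = _ , face-023 , separates-in only-1F (inTriangle-rotate (inTriangle-rotate t))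
        (λ s → ¬inTriangle-exchange (inTriangle-rotate cz) (inTriangle-rotate s))
    ...     | inj₂ (inj₂ t) = _ , face-013 , separates-in only-2F (inTriangle-swap₁₂ (inTriangle-rotate t))
        (λ s → ¬inTriangle-exchange (inTriangle-swap₂₃ cz) (inTriangle-rotate s))

  facesSeparate : ∀ {n G F} → Stacked n G F → ∀ {P} → LabelledEmbedding G P → FacesSeparate G F P
  facesSeparate base le = BaseCase.facesSeparate-K4 le
  facesSeparate (step s i j k m) le⁺ =
    Extension.Step.facesSeparate-step (wellFormed s) i j k (WellFormed.sorted (wellFormed s) m) le⁺
        (facesSeparate s (restrict le⁺)) m

  labelledEmbedding-unique : ∀ {n G F G′ F′} → Stacked n G F → Stacked n G′ F′ → ∀ {P} →
    LabelledEmbedding G P → LabelledEmbedding G′ P → G ≡ G′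
  labelledEmbedding-unique base base _ _ = refl
  labelledEmbedding-unique base (step s _ _ _ _) _ _ with WellFormed.4≤n (wellFormed s)
  ... | s≤s (s≤s (s≤s ()))
  labelledEmbedding-unique (step s _ _ _ _) base _ _ with WellFormed.4≤n (wellFormed s)
  ... | s≤s (s≤s (s≤s ()))
  labelledEmbedding-unique (step {G = G} s i j k m) (step s′ i′ j′ k′ m′) {P} le le′
    with refl ← labelledEmbedding-unique s s′ (restrict le) (restrict le′)
    with g , g∈ , g-separates ← facesSeparate s (restrict le) (P (fromℕ _))
                                  (Extension.new-offDrawing (wellFormed s) i j k (WellFormed.sorted (wellFormed s) m) le)
    = cong (λ (a , b , c) → extend G a b c)
        (trans (sym (Extension.separating-face-attached (wellFormed s) i j k (WellFormed.sorted (wellFormed s) m) le g g∈ g-separates))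
               (Extension.separating-face-attached (wellFormed s) i′ j′ k′ (WellFormed.sorted (wellFormed s′) m′) le′ g g∈ g-separates))

module EmbeddingCounts {c ℓ ℓ<} (𝔽 : OrderedField c ℓ ℓ<) where

  open import Data.Nat as ℕ using (ℕ; suc; z≤n; s≤s; _+_; _!)
  import Data.Nat.Properties as ℕ
  open import Data.Fin using (Fin)
  open import Data.List using (List; []; _∷_; length)
  open import Data.List.Relation.Unary.Any using (here; there)
  import Data.List.Relation.Unary.All as All
  open import Data.List.Relation.Unary.AllPairs using (_∷_)
  open import Data.List.Membership.Propositional using (_∈_)
  open import Data.List.Relation.Unary.Unique.Propositional using (Unique)
  open import Data.Product using (∃; _×_; _,_; proj₁; proj₂)
  open import Data.Sum using (_⊎_)
  open import Data.Empty using (⊥-elim)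
  open import Relation.Nullary using (¬_)
  open import Relation.Binary.PropositionalEquality using (_≡_; refl; sym; cong; subst)
  open Plane 𝔽
  open EmbeddingUniqueness 𝔽 using (labelledEmbedding-unique)
  open StackedCount using (stackedCount; stackedCount≤)
  open InjectionCount using (length≤n!-of-injection-labelled)

  unique-all-equal⇒length≤1 : ∀ {A : Set} (xs : List A) → Unique xs → (∀ {x y} → x ∈ xs → y ∈ xs → x ≡ y) → length xs ℕ.≤ 1
  unique-all-equal⇒length≤1 []           _       _     = z≤n
  unique-all-equal⇒length≤1 (x ∷ [])     _       _     = s≤s z≤n
  unique-all-equal⇒length≤1 (x ∷ y ∷ xs) (x∉ ∷ _) equal = ⊥-elim (All.head x∉ (equal (here refl) (there (here refl))))

  labelledEmbedding-≗ : ∀ {n} {G : Graph n} {P Q : Fin n → Point} → (∀ v → P v ≡ Q v) →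
    LabelledEmbedding G P → LabelledEmbedding G Q
  labelledEmbedding-≗ {G = G} {P} {Q} P≗Q
      (distinct , vertex-on-edge , edges-meet) = distinct′ , vertex-on-edge′ , edges-meet′
    where
    onSeg-≡ : ∀ {a a′ b b′ q q′ : Point} → a ≡ a′ → b ≡ b′ → q ≡ q′ → OnSeg a b q → OnSeg a′ b′ q′
    onSeg-≡ refl refl refl s = s
    distinct′ : ∀ i j → Q i ≈ₚ Q j → i ≡ j
    distinct′ i j e = distinct i j (subst (λ z → z ≈ₚ P j) (sym (P≗Q i)) (subst (λ z → Q i ≈ₚ z) (sym (P≗Q j)) e))
    vertex-on-edge′ : ∀ a b v → Adj G a b → OnSeg (Q a) (Q b) (Q v) → (v ≡ a) ⊎ (v ≡ b)
    vertex-on-edge′ a b v e s = vertex-on-edge a b v e (onSeg-≡ (sym (P≗Q a)) (sym (P≗Q b)) (sym (P≗Q v)) s)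
    edges-meet′ : ∀ a b a′ b′ → Adj G a b → Adj G a′ b′ →
      ¬ ((a ≡ a′) × (b ≡ b′)) → ¬ ((a ≡ b′) × (b ≡ a′)) →
      ∀ q → OnSeg (Q a) (Q b) q → OnSeg (Q a′) (Q b′) q →
      ∃ λ v → ((v ≡ a) ⊎ (v ≡ b)) × ((v ≡ a′) ⊎ (v ≡ b′)) × (q ≈ₚ Q v)
    edges-meet′ a b a′ b′ e e′ ≢₁ ≢₂ q s s′
      with v , v∈ab , v∈a′b′ , q≈Pv ← edges-meet a b a′ b′ e e′ ≢₁ ≢₂ q
             (onSeg-≡ (sym (P≗Q a)) (sym (P≗Q b)) refl s) (onSeg-≡ (sym (P≗Q a′)) (sym (P≗Q b′)) refl s′)
      = v , v∈ab , v∈a′b′ , subst (q ≈ₚ_) (P≗Q v) q≈Pv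

  labelled-count : ∀ d (Ts : List (Graph (4 + d))) → EnumT (4 + d) Ts →
    ∀ (P : Fin (4 + d) → Point) (Es : List (Graph (4 + d))) → Unique Es →
    (∀ G → G ∈ Es → InT (4 + d) G × LabelledEmbedding G P) →
    length Es ℕ.* stackedCount d ℕ.≤ length Ts
  labelled-count d Ts enum P Es uEs embeds = begin
    length Es ℕ.* stackedCount d ≤⟨ ℕ.*-monoˡ-≤ (stackedCount d) (unique-all-equal⇒length≤1 Es uEs all-equal) ⟩
    1 ℕ.* stackedCount d         ≡⟨ ℕ.*-identityˡ (stackedCount d) ⟩
    stackedCount d               ≤⟨ stackedCount≤ d Ts enum ⟩
    length Ts                    ∎
    where
    open ℕ.≤-Reasoning
    all-equal : ∀ {G H} → G ∈ Es → H ∈ Es → G ≡ H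
    all-equal {G} {H} G∈ H∈ with (_ , s) , le ← embeds G G∈ |
        (_ , s′) , le′ ← embeds H H∈ = labelledEmbedding-unique s s′ le le′

  unlabelled-count : ∀ d (P : Fin (4 + d) → Point) (Es : List (Graph (4 + d))) → Unique Es →
    (∀ G → G ∈ Es → InT (4 + d) G × Embedding G P) →
    length Es ℕ.≤ (4 + d) !
  unlabelled-count d P Es uEs embeds =
    length≤n!-of-injection-labelled Es uEs σ (λ p → proj₁ (proj₂ (proj₂ (embeds _ p)))) σ-determines
    where
    σ : ∀ {G} → G ∈ Es → Fin (4 + d) → Fin (4 + d)
    σ {G} p = proj₁ (proj₂ (embeds G p))
    σ-determines : ∀ {G H} (p : G ∈ Es) (q : H ∈ Es) → (∀ v → σ p v ≡ σ q v) → G ≡ H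
    σ-determines {G} {H} p q σ≗ with (_ , s) , (_ , _ , le) ← embeds G p | (_ , s′) , (_ , _ , le′) ← embeds H q =
      labelledEmbedding-unique s s′ le (labelledEmbedding-≗ {G = H} (λ v → cong P (sym (σ≗ v))) le′)

  n!2ⁿ≡16n[n-1][n-2]·stackedCount : ∀ d → (4 + d) ! ℕ.* 2 ℕ.^ (4 + d) ≡ 16 ℕ.* (4 + d) ℕ.* (3 + d) ℕ.*
      (2 + d) ℕ.* stackedCount d
  n!2ⁿ≡16n[n-1][n-2]·stackedCount d = solve 3 (λ x f d →
    ((con 4 :+ d) :* ((con 3 :+ d) :* ((con 2 :+ d) :* f))) :* (con 2 :* (con 2 :* (con 2 :* (con 2 :* x))))
      := con 16 :* (con 4 :+ d) :* (con 3 :+ d) :* (con 2 :+ d) :* (x :* f)) refl (2 ℕ.^ d) (suc d !) d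
    where
    open import Data.Nat.Solver using (module +-*-Solver)
    open +-*-Solver

  unlabelled-count-vs-𝒯 : ∀ d (Ts : List (Graph (4 + d))) → EnumT (4 + d) Ts →
    ∀ (P : Fin (4 + d) → Point) (Es : List (Graph (4 + d))) → Unique Es →
    (∀ G → G ∈ Es → InT (4 + d) G × Embedding G P) →
    length Es ℕ.* 2 ℕ.^ (4 + d) ℕ.≤ 16 ℕ.* (4 + d) ℕ.* (3 + d) ℕ.* (2 + d) ℕ.* length Ts
  unlabelled-count-vs-𝒯 d Ts enum P Es uEs embeds = begin
    length Es ℕ.* 2 ℕ.^ (4 + d)          ≤⟨ ℕ.*-monoˡ-≤ (2 ℕ.^ (4 + d)) (unlabelled-count d P Es uEs embeds) ⟩
    (4 + d) ! ℕ.* 2 ℕ.^ (4 + d)          ≡⟨ n!2ⁿ≡16n[n-1][n-2]·stackedCount d ⟩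
    16n[n-1][n-2] ℕ.* stackedCount d    ≤⟨ ℕ.*-monoʳ-≤ 16n[n-1][n-2] (stackedCount≤ d Ts enum) ⟩
    16n[n-1][n-2] ℕ.* length Ts         ∎
    where
    open ℕ.≤-Reasoning
    16n[n-1][n-2] : ℕ
    16n[n-1][n-2] = 16 ℕ.* (4 + d) ℕ.* (3 + d) ℕ.* (2 + d)

open import Data.Nat using (ℕ; suc; s≤s; _*_; _∸_; _^_; _≤_; _!)
open import Data.Fin using (Fin)
open import Data.List using (List; length)
open import Data.List.Membership.Propositional using (_∈_)
open import Data.List.Relation.Unary.Unique.Propositional using (Unique)
open import Data.Product using (_×_; _,_)

corollary2 : ∀ {c ℓ ℓ<} (𝔽 : OrderedField c ℓ ℓ<) (n : ℕ) → 4 ≤ n →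
    (Ts : List (Graph n)) → EnumT n Ts →
    (∀ (P : Fin n → Plane.Point 𝔽) → Plane.Distinct 𝔽 P →
       (Es : List (Graph n)) → Unique Es →
       (∀ G → G ∈ Es → InT n G × Plane.LabelledEmbedding 𝔽 G P) →
       length Es * (2 ^ (n ∸ 4) * (n ∸ 3) !) ≤ length Ts)
    ×
    (∀ (P : Fin n → Plane.Point 𝔽) → Plane.Distinct 𝔽 P →
       (Es : List (Graph n)) → Unique Es →
       (∀ G → G ∈ Es → InT n G × Plane.Embedding 𝔽 G P) →
       length Es * 2 ^ n ≤ 16 * n * (n ∸ 1) * (n ∸ 2) * length Ts)
-- Distinctness of P is already the first component of a labelled embedding.
corollary2 𝔽 (suc (suc (suc (suc d)))) (s≤s (s≤s (s≤s (s≤s _)))) Ts enum =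
  (λ P _ → EmbeddingCounts.labelled-count 𝔽 d Ts enum P) ,
  (λ P _ → EmbeddingCounts.unlabelled-count-vs-𝒯 𝔽 d Ts enum P)
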